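{- Let $\lambda$ be a partition with at most $n$ parts; let $\beta,\beta'\in U_\lambda(n)$, $\eta,\eta'\in UGC_\lambda(n)$, $\varphi,\varphi'\in UF_\lambda(n)$. Write $\beta\sim\beta'$ when $\mathcal{S}_\lambda(\beta)=\mathcal{S}_\lambda(\beta')$. (i) The sets $\mathcal{S}_\lambda(\beta)$, $\beta\in U_\lambda(n)$, are precisely indexed by $UI_\lambda(n)$: each $\sim$-class in $U_\lambda(n)$ contains exactly one element of $UI_\lambda(n)$, and that element is the minimum (entrywise) of the class. Moreover $\mathcal{S}_\lambda(\beta)=\mathcal{S}_\lambda(\beta')$ iff $\beta\sim\beta'$ iff $\Delta_\lambda(\beta)=\Delta_\lambda(\beta')$. (ii) The sets $\mathcal{S}_\lambda(\eta)$, $\eta\in UGC_\lambda(n)$, are precisely indexed by $UG_\lambda(n)$: each $\sim$-class of $UGC_\lambda(n)$ contains exactly one element of $UG_\lambda(n)$, which is the minimum of the class; the $\sim$-class of $\eta$ within $UGC_\lambda(n)$ coincides with its $\sim$-class within $U_\lambda(n)$. Moreover $\mathcal{S}_\lambda(\eta)=\mathcal{S}_\lambda(\eta')$ iff $\eta\sim\eta'$ iff $\Delta_\lambda(\eta)=\Delta_\lambda(\eta')$. (iii) The sets $\mathcal{S}_\lambda(\varphi)$, $\varphi\in UF_\lambda(n)$, are precisely indexed by the $\lambda$-floor flags: each $\sim$-class of $UF_\lambda(n)$ contains exactly one $\lambda$-floor flag, which is the minimum of that class. Moreover $\mathcal{S}_\lambda(\varphi)=\mathcal{S}_\lambda(\varphi')$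 iff $\varphi\sim\varphi'$ iff $\Phi_\lambda[\Delta_\lambda(\varphi)]=\Phi_\lambda[\Delta_\lambda(\varphi')]$. The flag bound sets $\mathcal{S}_\lambda(\varphi)$ can also be faithfully (injectively) indexed as $\mathcal{S}_\lambda(\gamma)$ with $\gamma:=\Delta_\lambda(\varphi)\in UG_\lambda(n)$, and $\mathcal{S}_\lambda(\varphi)=\mathcal{S}_\lambda(\Delta_\lambda(\varphi))$.
   Context: Fix $n\ge1$, $[n]=\{1,\dots,n\}$. A partition $\lambda=(\lambda_1\ge\dots\ge\lambda_n\ge0)$; box $(j,i)$ of its shape is in column $j$, row $i$. $R_\lambda\subseteq[n-1]$ is the set of distinct column lengths of $\lambda$ less than $n$, written $q_1<\dots<q_r$, $q_0:=0$, $q_{r+1}:=n$; carrels are $(q_{h-1},q_h]$, $h\in[r+1]$. A $\lambda$-tuple is an $n$-tuple with entries in $[n]$ with these carrels; upper if $\beta_i\ge i$. $U_\lambda(n)$: upper $\lambda$-tuples; $UF_\lambda(n)$: weakly increasing upper ones; $UI_\lambda(n)$: upper ones strictly increasing on each carrel. Critical list of $\beta\in U_\lambda(n)$: in carrel $h$ put $x_1:=q_h$; recursively let $x_u$ be the largest index with $q_{h-1}<x_u<x_{u-1}$ and $\beta_{x_{u-1}}-\beta_{x_u}>x_{u-1}-x_u$, stopping when none exists; these are critical indices with critical entries $\beta_{x_u}$. $\lambda$-core: $\Delta_\lambda(\beta)_i:=\beta_x-(x-i)$, $x$ the smallest critical index $\ge i$ in the carrel of $i$. $UGC_\lambda(n)$: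 those $\beta$ whose critical entries, listed by increasing critical index, weakly increase; $UG_\lambda(n):=UGC_\lambda(n)\cap UI_\lambda(n)$. A $\lambda$-floor flag is $\tau\in UF_\lambda(n)$ such that every plateau of $\tau$ (maximal run of consecutive equal entries) of length at least $2$ starts at an index $q_h$ with $h\in[r]$. $\lambda$-floor map: for $\gamma\in UG_\lambda(n)$, $\Phi_\lambda(\gamma)=\tau$ with $\tau_x=\gamma_x$ at critical indices $x$ of $\gamma$, and for non-critical $i$, with $x$ the smallest critical index $\ge i$ in the carrel of $i$: $\tau_i:=\max\{\gamma_{q_h},\gamma_x-(x-i)\}$ if $i$ is in carrel $h+1$ ($h\in[r]$) and $x$ is the smallest critical index of that carrel, else $\tau_i:=\gamma_x-(x-i)$. $\mathcal{T}_\lambda$: semistandard tableaux of shape $\lambda$ with entries in $[n]$; $T_j(i)$ the entry in box $(j,i)$. $\mathcal{S}_\lambda(\beta):=\{T\in\mathcal{T}_\lambda:T_j(i)\le\beta_i\text{ for all boxes }(j,i)\}$. -}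

module Defs where

open import Data.Nat using (ℕ; zero; suc; _+_; _∸_; _≤_; _<_; _⊔_; _≤?_; _<?_; _≟_)
open import Data.Bool using (Bool; true; false; if_then_else_; _∧_; T; T?)
open import Data.List using (List; []; _∷_; map; filter; length; upTo; reverse; concatMap; _++_)
open import Data.Bool.ListAction using (any)
open import Data.Maybe using (Maybe; just; nothing)
open import Data.Product using (_×_; ∃)
open import Data.Sum using (_⊎_)
open import Relation.Nullary using (¬_)
open import Relation.Nullary.Decidable using (⌊_⌋)
open import Relation.Binary.PropositionalEquality using (_≡_; _≢_)

-- Indices are 1-based natural numbers: an
-- n-tuple β is a function ℕ → ℕ of which only the values β 1, …, β n
-- matter (all predicates below only look at indices in [n]); likewise a
-- partition λ (called `lam`, since λ is an Agda keyword) is a function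
-- with parts lam 1 ≥ … ≥ lam n ≥ 0.  A tableau T is a function
-- ℕ → ℕ → ℕ with T j i the entry in box (j , i) (column j, row i).

interval : ℕ → ℕ → List ℕ
interval a b = map (a +_) (upTo (suc b ∸ a))

findFirst : (ℕ → Bool) → List ℕ → Maybe ℕ
findFirst p [] = nothing
findFirst p (x ∷ xs) = if p x then just x else findFirst p xs

findLast : (ℕ → Bool) → List ℕ → Maybe ℕ
findLast p xs = findFirst p (reverse xs)

fromMaybe : ℕ → Maybe ℕ → ℕ
fromMaybe d nothing = d
fromMaybe d (just x) = x

elemB : ℕ → List ℕ → Bool
elemB x xs = any (λ y → ⌊ x ≟ y ⌋) xs

IsPartition : ℕ → (ℕ → ℕ) → Set
IsPartition n lam = ∀ i → 1 ≤ i → i < n → lam (suc i) ≤ lam i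

colLen : ℕ → (ℕ → ℕ) → ℕ → ℕ
colLen n lam j = length (filter (λ i → j ≤? lam i) (interval 1 n))

inR : ℕ → (ℕ → ℕ) → ℕ → Bool
inR n lam q = ⌊ 1 ≤? q ⌋ ∧ (⌊ q <? n ⌋ ∧ any (λ j → ⌊ colLen n lam j ≟ q ⌋) (interval 1 (lam 1)))

-- upper end q_h of the carrel (q_{h-1}, q_h] containing i ∈ [n]
carrelTop : ℕ → (ℕ → ℕ) → ℕ → ℕ
carrelTop n lam i = fromMaybe n (findFirst (inR n lam) (interval i (n ∸ 1)))

carrelBot : ℕ → (ℕ → ℕ) → ℕ → ℕ
carrelBot n lam i = fromMaybe 0 (findLast (inR n lam) (interval 1 (i ∸ 1)))

SameCarrel : ℕ → (ℕ → ℕ) → ℕ → ℕ → Set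
SameCarrel n lam i k = carrelTop n lam i ≡ carrelTop n lam k

carrelTops : ℕ → (ℕ → ℕ) → List ℕ
carrelTops n lam = filter (λ q → T? (inR n lam q)) (interval 1 (n ∸ 1)) ++ (n ∷ [])

IsLamTuple : ℕ → (ℕ → ℕ) → Set
IsLamTuple n β = ∀ i → 1 ≤ i → i ≤ n → 1 ≤ β i × β i ≤ n

IsUpperB : ℕ → (ℕ → ℕ) → Set
IsUpperB n β = ∀ i → 1 ≤ i → i ≤ n → i ≤ β i

U : ℕ → (ℕ → ℕ) → (ℕ → ℕ) → Set
U n lam β = IsLamTuple n β × IsUpperB n β

UF : ℕ → (ℕ → ℕ) → (ℕ → ℕ) → Set
UF n lam β = U n lam β × (∀ i k → 1 ≤ i → i ≤ k → k ≤ n → β i ≤ β k)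

UI : ℕ → (ℕ → ℕ) → (ℕ → ℕ) → Set
UI n lam β = U n lam β ×
  (∀ i k → 1 ≤ i → i < k → k ≤ n → SameCarrel n lam i k → β i < β k)

_≈[_]_ : (ℕ → ℕ) → ℕ → (ℕ → ℕ) → Set
β ≈[ n ] β' = ∀ i → 1 ≤ i → i ≤ n → β i ≡ β' i

_≤[_]_ : (ℕ → ℕ) → ℕ → (ℕ → ℕ) → Set
β ≤[ n ] β' = ∀ i → 1 ≤ i → i ≤ n → β i ≤ β' i

-- critChain β a x fuel : the critical list x = x_1 > x_2 > … of a carrel
-- (a , b], started at x; x_u is the largest y with a < y < x_{u-1} and
-- β x_{u-1} - β y > x_{u-1} - y  (i.e. x_{u-1} + β y < β x_{u-1} + y).
critChain : (ℕ → ℕ) → ℕ → ℕ → ℕ → List ℕ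
critChain β a x zero = x ∷ []
critChain β a x (suc f) with findLast (λ y → ⌊ x + β y <? β x + y ⌋) (interval (suc a) (x ∸ 1))
... | nothing = x ∷ []
... | just y = x ∷ critChain β a y f

-- all critical indices of β (fuel n suffices, chains have length ≤ n)
criticalIndices : ℕ → (ℕ → ℕ) → (ℕ → ℕ) → List ℕ
criticalIndices n lam β =
  concatMap (λ b → critChain β (carrelBot n lam b) b n) (carrelTops n lam)

isCrit : ℕ → (ℕ → ℕ) → (ℕ → ℕ) → ℕ → Bool
isCrit n lam β x = elemB x (criticalIndices n lam β)

IsCritical : ℕ → (ℕ → ℕ) → (ℕ → ℕ) → ℕ → Set
IsCritical n lam β x = T (isCrit n lam β x)

nextCrit : ℕ → (ℕ → ℕ) → (ℕ → ℕ) → ℕ → ℕ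
nextCrit n lam β i =
  fromMaybe (carrelTop n lam i) (findFirst (isCrit n lam β) (interval i (carrelTop n lam i)))

firstCritOfCarrel : ℕ → (ℕ → ℕ) → (ℕ → ℕ) → ℕ → ℕ
firstCritOfCarrel n lam β i =
  fromMaybe (carrelTop n lam i)
    (findFirst (isCrit n lam β) (interval (suc (carrelBot n lam i)) (carrelTop n lam i)))

core : ℕ → (ℕ → ℕ) → (ℕ → ℕ) → (ℕ → ℕ)
core n lam β i = β (nextCrit n lam β i) ∸ (nextCrit n lam β i ∸ i)

UGC : ℕ → (ℕ → ℕ) → (ℕ → ℕ) → Set
UGC n lam β = U n lam β ×
  (∀ x x' → IsCritical n lam β x → IsCritical n lam β x' → x < x' → β x ≤ β x')

UG : ℕ → (ℕ → ℕ) → (ℕ → ℕ) → Set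
UG n lam β = UGC n lam β × UI n lam β

-- every plateau [s , e] of τ of length ≥ 2 (s < e) starts at some q_h, h ∈ [r]
IsFloorFlag : ℕ → (ℕ → ℕ) → (ℕ → ℕ) → Set
IsFloorFlag n lam τ = UF n lam τ ×
  (∀ s e → 1 ≤ s → s < e → e ≤ n →
     (∀ k → s ≤ k → k ≤ e → τ k ≡ τ s) →
     (s ≡ 1 ⊎ τ (s ∸ 1) ≢ τ s) →
     (e ≡ n ⊎ τ (suc e) ≢ τ e) →
     T (inR n lam s))

floorMap : ℕ → (ℕ → ℕ) → (ℕ → ℕ) → (ℕ → ℕ)
floorMap n lam γ i =
  if isCrit n lam γ i then γ i
  else (if inR n lam (carrelBot n lam i) ∧ ⌊ x ≟ firstCritOfCarrel n lam γ i ⌋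
        then γ (carrelBot n lam i) ⊔ (γ x ∸ (x ∸ i))
        else γ x ∸ (x ∸ i))
  where
  x : ℕ
  x = nextCrit n lam γ i

Box : ℕ → (ℕ → ℕ) → ℕ → ℕ → Set
Box n lam j i = 1 ≤ i × i ≤ n × 1 ≤ j × j ≤ lam i

IsSSYT : ℕ → (ℕ → ℕ) → (ℕ → ℕ → ℕ) → Set
IsSSYT n lam T' =
  (∀ j i → Box n lam j i → 1 ≤ T' j i × T' j i ≤ n) ×
  (∀ j i → Box n lam j i → Box n lam (suc j) i → T' j i ≤ T' (suc j) i) ×
  (∀ j i → Box n lam j i → Box n lam j (suc i) → T' j i < T' j (suc i))

InS : ℕ → (ℕ → ℕ) → (ℕ → ℕ) → (ℕ → ℕ → ℕ) → Set
InS n lam β T' = IsSSYT n lam T' × (∀ j i → Box n lam j i → T' j i ≤ β i)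

Sim : ℕ → (ℕ → ℕ) → (ℕ → ℕ) → (ℕ → ℕ) → Set
Sim n lam β β' = ∀ T' → (InS n lam β T' → InS n lam β' T') × (InS n lam β' T' → InS n lam β T')

module Submission where

-- For an upper tuple β the core value at i is Δ_λ(β)_i = i + min { β_k − k : k ≥ i in the carrel of i },
-- the minimum being attained at the next critical index. All rows of a carrel have the same length, so a
-- column of a semistandard tableau rises by at least one per row inside a carrel, whence T_j(i) ≤ Δ_λ(β)_i
-- for every T ∈ 𝒮_λ(β). Conversely, putting Δ_λ(β) into the columns that end inside the carrel of i, and k
-- into every other box of row k, gives a tableau of 𝒮_λ(β) with Δ_λ(β)_i at the end of row i. Hence
-- 𝒮_λ(β) and Δ_λ(β) determine each other, and Δ_λ(β) is the least element of its class and the only one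
-- increasing strictly on carrels; critical indices and entries are read off the core, which gives (ii).
-- For a flag φ the least flag of its class is τ_i = max (Δ_λ(φ)_i , Δ_λ(φ)_{q_{h-1}}) on carrel h: it lies
-- between Δ_λ(φ) and φ, so it has the same core; since the core rises strictly inside a carrel, a plateau
-- of τ can only start at a carrel boundary; every floor flag of the class lies below τ, by the same
-- plateau argument; and Φ_λ computes exactly τ from Δ_λ(φ).

open import Defs
open import Data.Nat
open import Data.Nat.Properties
open import Data.Nat.Tactic.RingSolver using (solve)
open import Data.Bool using (Bool; true; false; T; T?; _∧_; if_then_else_)
open import Data.Bool.Properties using (T-∧)
open import Data.List using (List; []; _∷_; filter; length; applyUpTo; applyDownFrom)
open import Data.List.Properties using (map-upTo; reverse-applyUpTo; filter-accept; filter-reject)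
open import Data.List.Membership.Propositional using (_∈_; find; lose)
open import Data.List.Membership.Propositional.Properties
  using (∈-map⁺; ∈-upTo⁺; ∈-concatMap⁺; ∈-concatMap⁻; ∈-++⁺ˡ; ∈-++⁺ʳ; ∈-++⁻; ∈-filter⁺; ∈-filter⁻)
open import Data.List.Relation.Unary.Any as Any using (here; there)
open import Data.List.Relation.Unary.Any.Properties using (any⁺; any⁻)
open import Data.Maybe using (Maybe; just; nothing)
open import Data.Product using (_×_; ∃; _,_; proj₁; proj₂; swap)
open import Data.Sum using (_⊎_; inj₁; inj₂; [_,_]′; map₂)
open import Data.Empty using (⊥-elim)
open import Function using (_∘_)
open import Function.Bundles using (Equivalence; _⇔_; mk⇔)
open import Function.Properties.Equivalence using () renaming (sym to ⇔-sym)
open import Relation.Binary.Definitions using (tri<; tri≈; tri>)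
open import Relation.Binary.PropositionalEquality
open import Relation.Nullary using (¬_; Dec; yes; no)
open import Relation.Nullary.Decidable using (toWitness; fromWitness; ⌊_⌋; _×-dec_; _⊎-dec_)
open import Relation.Unary using (Decidable)

≤∸1⇒< : ∀ {x y} → 1 ≤ y → y ≤ x ∸ 1 → y < x
≤∸1⇒< {zero} 1≤y y≤0 = ⊥-elim (<⇒≱ 1≤y y≤0)
≤∸1⇒< {suc x} _ y≤x = s≤s y≤x

<⇒≤∸1 : ∀ {x y} → y < x → y ≤ x ∸ 1
<⇒≤∸1 {suc x} (s≤s y≤x) = y≤x

m∸[n∸o]+n≡m+o : ∀ {m n o} → o ≤ n → n ∸ o ≤ m → m ∸ (n ∸ o) + n ≡ m + o
m∸[n∸o]+n≡m+o {m} {n} {o} o≤n n∸o≤m = begin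
  m ∸ (n ∸ o) + n             ≡⟨ cong (m ∸ (n ∸ o) +_) (sym (m∸n+n≡m o≤n)) ⟩
  m ∸ (n ∸ o) + (n ∸ o + o)   ≡⟨ sym (+-assoc (m ∸ (n ∸ o)) (n ∸ o) o) ⟩
  m ∸ (n ∸ o) + (n ∸ o) + o   ≡⟨ cong (_+ o) (m∸n+n≡m n∸o≤m) ⟩
  m + o                       ∎
  where open ≡-Reasoning

-- (a , x) ≤ᵈ (b , y) compares a − x with b − y without truncated subtraction.
infix 4 _≤ᵈ_ _<ᵈ_

record _≤ᵈ_ (p q : ℕ × ℕ) : Set where
  constructor diff≤
  field unDiff≤ : proj₁ p + proj₂ q ≤ proj₁ q + proj₂ p

record _<ᵈ_ (p q : ℕ × ℕ) : Set where
  constructor diff<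
  field unDiff< : proj₁ p + proj₂ q < proj₁ q + proj₂ p

private
  interchange : ∀ a b y z → (a + y) + (b + z) ≡ (a + z) + (b + y)
  interchange a b y z = solve (a ∷ b ∷ y ∷ z ∷ [])

  interchange′ : ∀ b c x y → (b + x) + (c + y) ≡ (c + x) + (b + y)
  interchange′ b c x y = solve (b ∷ c ∷ x ∷ y ∷ [])

≤ᵈ-refl : ∀ {p} → p ≤ᵈ p
≤ᵈ-refl = diff≤ ≤-refl

<ᵈ⇒≤ᵈ : ∀ {p q} → p <ᵈ q → p ≤ᵈ q
<ᵈ⇒≤ᵈ (diff< h) = diff≤ (<⇒≤ h)

≤ᵈ-trans : ∀ {a b c x y z} → (a , x) ≤ᵈ (b , y) → (b , y) ≤ᵈ (c , z) → (a , x) ≤ᵈ (c , z)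
≤ᵈ-trans {a} {b} {c} {x} {y} {z} (diff≤ h) (diff≤ h′) = diff≤ (+-cancelʳ-≤ (b + y) (a + z) (c + x)
  (subst₂ _≤_ (interchange a b y z) (interchange′ b c x y) (+-mono-≤ h h′)))

<ᵈ-≤ᵈ-trans : ∀ {a b c x y z} → (a , x) <ᵈ (b , y) → (b , y) ≤ᵈ (c , z) → (a , x) <ᵈ (c , z)
<ᵈ-≤ᵈ-trans {a} {b} {c} {x} {y} {z} (diff< h) (diff≤ h′) = diff< (+-cancelʳ-< (b + y) (a + z) (c + x)
  (subst₂ _<_ (interchange a b y z) (interchange′ b c x y) (+-mono-<-≤ h h′)))

≤ᵈ-<ᵈ-trans : ∀ {a b c x y z} → (a , x) ≤ᵈ (b , y) → (b , y) <ᵈ (c , z) → (a , x) <ᵈ (c , z)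
≤ᵈ-<ᵈ-trans {a} {b} {c} {x} {y} {z} (diff≤ h) (diff< h′) = diff< (+-cancelʳ-< (b + y) (a + z) (c + x)
  (subst₂ _<_ (interchange a b y z) (interchange′ b c x y) (+-mono-≤-< h h′)))

<ᵈ⇒≱ᵈ : ∀ {p q} → p <ᵈ q → ¬ q ≤ᵈ p
<ᵈ⇒≱ᵈ (diff< h) (diff≤ h′) = <⇒≱ h h′

≤ᵈ⇒≤ : ∀ {a b x} → (a , x) ≤ᵈ (b , x) → a ≤ b
≤ᵈ⇒≤ {a} {b} {x} (diff≤ h) = +-cancelʳ-≤ x a b h

≤⇒≤ᵈ : ∀ {a b x} → a ≤ b → (a , x) ≤ᵈ (b , x)
≤⇒≤ᵈ h = diff≤ (+-monoˡ-≤ _ h)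

diagonal-≤ᵈ : ∀ x y → (x , x) ≤ᵈ (y , y)
diagonal-≤ᵈ x y = diff≤ (≤-reflexive (+-comm x y))

≤ᵈ-<⇒< : ∀ {a b x y} → (a , x) ≤ᵈ (b , y) → x < y → a < b
≤ᵈ-<⇒< {a} {b} {x} {y} (diff≤ h) x<y = +-cancelʳ-< y a b (≤-<-trans h (+-monoʳ-< b x<y))

≤ᵈ-≤⇒≤ : ∀ {a b x y} → (a , x) ≤ᵈ (b , y) → x ≤ y → a ≤ b
≤ᵈ-≤⇒≤ {a} {b} {x} {y} (diff≤ h) x≤y = +-cancelʳ-≤ y a b (≤-trans h (+-monoʳ-≤ b x≤y))

<⇒≤ᵈ-suc : ∀ {a b x} → a < b → (a , x) ≤ᵈ (b , suc x)
<⇒≤ᵈ-suc {a} {b} {x} a<b = diff≤ (subst (_≤ b + x) (sym (+-suc a x)) (+-monoˡ-≤ x a<b))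

stepwise-<⇒≤ᵈ : ∀ (f : ℕ → ℕ) {i k} → i ≤ k → (∀ m → i ≤ m → m < k → f m < f (suc m)) → (f i , i) ≤ᵈ (f k , k)
stepwise-<⇒≤ᵈ f {i} {k} i≤k steps with m≤n⇒m<n∨m≡n i≤k
... | inj₂ refl = ≤ᵈ-refl
... | inj₁ i<k with k | i<k
...   | suc k′ | s≤s i≤k′ = ≤ᵈ-trans (stepwise-<⇒≤ᵈ f i≤k′ (λ m i≤m m<k′ → steps m i≤m (m<n⇒m<1+n m<k′)))
                                     (<⇒≤ᵈ-suc (steps k′ i≤k′ ≤-refl))

stepwise-<-or-stall : ∀ (f : ℕ → ℕ) i k → i ≤ k →
  (∀ m → i ≤ m → m < k → f m < f (suc m)) ⊎ (∃ λ m → i ≤ m × m < k × f (suc m) ≤ f m)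
stepwise-<-or-stall f i k i≤k with m≤n⇒m<n∨m≡n i≤k
... | inj₂ refl = inj₁ λ m i≤m m<i → ⊥-elim (<⇒≱ m<i i≤m)
... | inj₁ i<k with k | i<k
...   | suc k′ | s≤s i≤k′ with stepwise-<-or-stall f i k′ i≤k′
...     | inj₂ (m , i≤m , m<k′ , stall) = inj₂ (m , i≤m , m<n⇒m<1+n m<k′ , stall)
...     | inj₁ steps with f k′ <? f (suc k′)
...       | no ¬step = inj₂ (k′ , i≤k′ , ≤-refl , ≮⇒≥ ¬step)
...       | yes step = inj₁ λ m i≤m m<k →
            [ (λ m<k′ → steps m i≤m m<k′) , (λ { refl → step }) ]′ (m≤n⇒m<n∨m≡n (≤-pred m<k))

plateauStart : ∀ (f : ℕ → ℕ) {m} → 1 ≤ m →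
  ∃ λ s → 1 ≤ s × s ≤ m × (∀ k → s ≤ k → k ≤ m → f k ≡ f s) × (s ≡ 1 ⊎ f (s ∸ 1) ≢ f s)
plateauStart f {suc m} _ = go m
  where
  go : ∀ m → ∃ λ s → 1 ≤ s × s ≤ suc m × (∀ k → s ≤ k → k ≤ suc m → f k ≡ f s) × (s ≡ 1 ⊎ f (s ∸ 1) ≢ f s)
  go zero = 1 , ≤-refl , ≤-refl , (λ k 1≤k k≤1 → cong f (≤-antisym k≤1 1≤k)) , inj₁ refl
  go (suc m) with f (suc m) ≟ f (suc (suc m)) | go m
  ... | no step | _ = suc (suc m) , s≤s z≤n , ≤-refl , (λ k s≤k k≤s → cong f (≤-antisym k≤s s≤k)) , inj₂ step
  ... | yes flat | s , 1≤s , s≤m , constant , start = s , 1≤s , m≤n⇒m≤1+n s≤m , constant′ , start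
    where
    constant′ : ∀ k → s ≤ k → k ≤ suc (suc m) → f k ≡ f s
    constant′ k s≤k k≤ssm with m≤n⇒m<n∨m≡n k≤ssm
    ... | inj₁ k<ssm = constant k s≤k (≤-pred k<ssm)
    ... | inj₂ refl = trans (sym flat) (constant (suc m) s≤m ≤-refl)

plateauEnd : ∀ (f : ℕ → ℕ) {m n} → m ≤ n →
  ∃ λ e → m ≤ e × e ≤ n × (∀ k → m ≤ k → k ≤ e → f k ≡ f m) × (e ≡ n ⊎ f (suc e) ≢ f e)
plateauEnd f {m} {n} m≤n = go (n ∸ m) (m+[n∸m]≡n m≤n)
  where
  go : ∀ d {m} → m + d ≡ n →
    ∃ λ e → m ≤ e × e ≤ n × (∀ k → m ≤ k → k ≤ e → f k ≡ f m) × (e ≡ n ⊎ f (suc e) ≢ f e)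
  go zero {m} m≡n = m , ≤-refl , ≤-reflexive m≡n′ , (λ k m≤k k≤m → cong f (≤-antisym k≤m m≤k)) , inj₁ m≡n′
    where
    m≡n′ : m ≡ n
    m≡n′ = trans (sym (+-identityʳ m)) m≡n
  go (suc d) {m} m+d≡n with f (suc m) ≟ f m
  ... | no step =
    m , ≤-refl , ≤-trans (m≤m+n m (suc d)) (≤-reflexive m+d≡n) , (λ k m≤k k≤m → cong f (≤-antisym k≤m m≤k)) , inj₂ step
  ... | yes flat with e , sm≤e , e≤n , constant , end ← go d {suc m} (trans (sym (+-suc m d)) m+d≡n) =
    e , ≤-trans (n≤1+n m) sm≤e , e≤n , constant′ , end
    where
    constant′ : ∀ k → m ≤ k → k ≤ e → f k ≡ f m
    constant′ k m≤k k≤e with m≤n⇒m<n∨m≡n m≤k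
    ... | inj₁ m<k = trans (constant k m<k k≤e) flat
    ... | inj₂ refl = refl

data FirstIndex (p : ℕ → Bool) (f : ℕ → ℕ) (k : ℕ) : Maybe ℕ → Set where
  none  : (∀ i → i < k → ¬ T (p (f i))) → FirstIndex p f k nothing
  found : ∀ {i} → i < k → T (p (f i)) → (∀ i′ → i′ < i → ¬ T (p (f i′))) → FirstIndex p f k (just (f i))

findFirst-applyUpTo : ∀ p f k → FirstIndex p f k (findFirst p (applyUpTo f k))
findFirst-applyUpTo p f zero = none λ _ ()
findFirst-applyUpTo p f (suc k) with p (f 0) in eq
... | true = found z<s (subst T (sym eq) _) λ _ ()
... | false with findFirst p (applyUpTo (f ∘ suc) k) | findFirst-applyUpTo p (f ∘ suc) k
...   | _ | none later = none λ where
          zero _ → subst (¬_ ∘ T) (sym eq) λ ()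
          (suc i) (s≤s i<k) → later i i<k
...   | _ | found i<k hit earlier = found (s≤s i<k) hit λ where
          zero _ → subst (¬_ ∘ T) (sym eq) λ ()
          (suc i′) (s≤s i′<i) → earlier i′ i′<i

data LastIndex (p : ℕ → Bool) (f : ℕ → ℕ) (k : ℕ) : Maybe ℕ → Set where
  none  : (∀ i → i < k → ¬ T (p (f i))) → LastIndex p f k nothing
  found : ∀ {i} → i < k → T (p (f i)) → (∀ i′ → i < i′ → i′ < k → ¬ T (p (f i′))) → LastIndex p f k (just (f i))

findFirst-applyDownFrom : ∀ p f k → LastIndex p f k (findFirst p (applyDownFrom f k))
findFirst-applyDownFrom p f zero = none λ _ ()
findFirst-applyDownFrom p f (suc k) with p (f k) in eq
... | true = found ≤-refl (subst T (sym eq) _) λ i′ k<i′ i′≤k → ⊥-elim (<⇒≱ k<i′ (≤-pred i′≤k))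
... | false with findFirst p (applyDownFrom f k) | findFirst-applyDownFrom p f k
...   | _ | none below = none λ i i≤k →
          [ below i , (λ { refl → subst (¬_ ∘ T) (sym eq) λ () }) ]′ (m≤n⇒m<n∨m≡n (≤-pred i≤k))
...   | _ | found i<k hit later = found (m<n⇒m<1+n i<k) hit λ i′ i<i′ i′≤k →
          [ later i′ i<i′ , (λ { refl → subst (¬_ ∘ T) (sym eq) λ () }) ]′ (m≤n⇒m<n∨m≡n (≤-pred i′≤k))

data FirstIn (p : ℕ → Bool) (a b : ℕ) : Maybe ℕ → Set where
  none  : (∀ y → a ≤ y → y ≤ b → ¬ T (p y)) → FirstIn p a b nothing
  found : ∀ {x} → a ≤ x → x ≤ b → T (p x) → (∀ y → a ≤ y → y < x → ¬ T (p y)) → FirstIn p a b (just x)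

data LastIn (p : ℕ → Bool) (a b : ℕ) : Maybe ℕ → Set where
  none  : (∀ y → a ≤ y → y ≤ b → ¬ T (p y)) → LastIn p a b nothing
  found : ∀ {x} → a ≤ x → x ≤ b → T (p x) → (∀ y → x < y → y ≤ b → ¬ T (p y)) → LastIn p a b (just x)

interval≡applyUpTo : ∀ a b → interval a b ≡ applyUpTo (a +_) (suc b ∸ a)
interval≡applyUpTo a b = map-upTo (a +_) (suc b ∸ a)

private
  offset-≤ : ∀ {a b i} → i < suc b ∸ a → a + i ≤ b
  offset-≤ {a} {b} {i} i<k with a ≤? suc b
  ... | yes a≤sb = subst (_≤ b) (+-comm i a) (≤-pred (m≤o∸n⇒m+n≤o (suc i) a≤sb i<k))
  ... | no a≰sb = ⊥-elim (<⇒≱ i<k (≤-trans (≤-reflexive (m≤n⇒m∸n≡0 (<⇒≤ (≰⇒> a≰sb)))) z≤n))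

  offset-< : ∀ {a b y} → a ≤ y → y ≤ b → y ∸ a < suc b ∸ a
  offset-< a≤y y≤b = ∸-monoˡ-< (s≤s y≤b) a≤y

  offset-≡ : ∀ {a y} → a ≤ y → a + (y ∸ a) ≡ y
  offset-≡ = m+[n∸m]≡n

  offset-mono-< : ∀ {a y z} → a ≤ y → y < a + z → y ∸ a < z
  offset-mono-< {a} {y} {z} a≤y y<az = subst (y ∸ a <_) (m+n∸m≡n a z) (∸-monoˡ-< y<az a≤y)

  offset-mono-> : ∀ {a z y} → a + z < y → z < y ∸ a
  offset-mono-> {a} {z} {y} az<y = subst (_< y ∸ a) (m+n∸m≡n a z) (∸-monoˡ-< az<y (m≤m+n a z))

findFirst-interval : ∀ p a b → FirstIn p a b (findFirst p (interval a b))
findFirst-interval p a b rewrite interval≡applyUpTo a b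
  with findFirst p (applyUpTo (a +_) (suc b ∸ a)) | findFirst-applyUpTo p (a +_) (suc b ∸ a)
... | _ | none miss = none λ y a≤y y≤b → subst (¬_ ∘ T ∘ p) (offset-≡ a≤y) (miss (y ∸ a) (offset-< a≤y y≤b))
... | _ | found i<k hit earlier = found (m≤m+n a _) (offset-≤ i<k) hit λ y a≤y y<x →
        subst (¬_ ∘ T ∘ p) (offset-≡ a≤y) (earlier (y ∸ a) (offset-mono-< a≤y y<x))

findLast-interval : ∀ p a b → LastIn p a b (findLast p (interval a b))
findLast-interval p a b
  rewrite interval≡applyUpTo a b | reverse-applyUpTo (a +_) (suc b ∸ a)
  with findFirst p (applyDownFrom (a +_) (suc b ∸ a)) | findFirst-applyDownFrom p (a +_) (suc b ∸ a)
... | _ | none miss = none λ y a≤y y≤b → subst (¬_ ∘ T ∘ p) (offset-≡ a≤y) (miss (y ∸ a) (offset-< a≤y y≤b))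
... | _ | found i<k hit later = found (m≤m+n a _) (offset-≤ i<k) hit λ y x<y y≤b →
        let a≤y = ≤-trans (m≤m+n a _) (<⇒≤ x<y) in
        subst (¬_ ∘ T ∘ p) (offset-≡ a≤y) (later (y ∸ a) (offset-mono-> x<y) (offset-< a≤y y≤b))

∈-interval⁺ : ∀ {y a b} → a ≤ y → y ≤ b → y ∈ interval a b
∈-interval⁺ {y} {a} {b} a≤y y≤b = subst (_∈ interval a b) (offset-≡ a≤y) (∈-map⁺ (a +_) (∈-upTo⁺ (offset-< a≤y y≤b)))

elemB⁻ : ∀ {x xs} → T (elemB x xs) → x ∈ xs
elemB⁻ {xs = xs} h = Any.map toWitness (any⁻ _ xs h)

elemB⁺ : ∀ {x xs} → x ∈ xs → T (elemB x xs)
elemB⁺ x∈ = any⁺ _ (Any.map fromWitness x∈)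

if-cases : ∀ {A : Set} b {x y v : A} → (T b → x ≡ v) → (¬ T b → y ≡ v) → (if b then x else y) ≡ v
if-cases true onTrue _ = onTrue _
if-cases false _ onFalse = onFalse λ ()

length-filter-applyUpTo : ∀ {P : ℕ → Set} (P? : Decidable P) f {k m} → m ≤ k →
  (∀ i → i < m → P (f i)) → (∀ i → m ≤ i → i < k → ¬ P (f i)) → length (filter P? (applyUpTo f k)) ≡ m
length-filter-applyUpTo P? f {zero} z≤n _ _ = refl
length-filter-applyUpTo P? f {suc k} {zero} _ _ fails
  rewrite filter-reject P? {xs = applyUpTo (f ∘ suc) k} (fails 0 z≤n z<s) =
    length-filter-applyUpTo P? (f ∘ suc) z≤n (λ _ ()) (λ i _ i<k → fails (suc i) z≤n (s≤s i<k))
length-filter-applyUpTo P? f {suc k} {suc m} (s≤s m≤k) holds fails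
  rewrite filter-accept P? {xs = applyUpTo (f ∘ suc) k} (holds 0 z<s) =
    cong suc (length-filter-applyUpTo P? (f ∘ suc) m≤k (λ i i<m → holds (suc i) (s≤s i<m))
                                                       (λ i m≤i i<k → fails (suc i) (s≤s m≤i) (s≤s i<k)))

module Partition (n : ℕ) (lam : ℕ → ℕ) (P : IsPartition n lam) where

  InR : ℕ → Set
  InR q = T (inR n lam q)

  lam-antitone : ∀ {i k} → 1 ≤ i → i ≤ k → k ≤ n → lam k ≤ lam i
  lam-antitone {i} {k} 1≤i i≤k k≤n with m≤n⇒m<n∨m≡n i≤k
  ... | inj₂ refl = ≤-refl
  ... | inj₁ i<k with k | i<k
  ...   | suc k′ | s≤s i≤k′ =
    ≤-trans (P k′ (≤-trans 1≤i i≤k′) k≤n) (lam-antitone 1≤i i≤k′ (≤-trans (n≤1+n k′) k≤n))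

  ColumnCut : ℕ → ℕ → ℕ → Set
  ColumnCut j k m = m ≤ k × (∀ y → 1 ≤ y → y ≤ m → j ≤ lam y) × (∀ y → m < y → y ≤ k → lam y < j)

  columnCut : ∀ j k → k ≤ n → ∃ (ColumnCut j k)
  columnCut j zero _ = 0 , z≤n , (λ y 1≤y y≤0 → ⊥-elim (<⇒≱ 1≤y y≤0)) , (λ y 0<y y≤0 → ⊥-elim (<⇒≱ 0<y y≤0))
  columnCut j (suc k) sk≤n with j ≤? lam (suc k)
  ... | yes j≤ =
    suc k , ≤-refl , (λ y 1≤y y≤sk → ≤-trans j≤ (lam-antitone 1≤y y≤sk sk≤n)) , (λ y sk<y y≤sk → ⊥-elim (<⇒≱ sk<y y≤sk))
  ... | no j≰ with m , m≤k , reach , miss ← columnCut j k (≤-trans (n≤1+n k) sk≤n) =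
    m , m≤n⇒m≤1+n m≤k , reach , λ y m<y y≤sk →
      [ (λ y<sk → miss y m<y (≤-pred y<sk)) , (λ { refl → ≰⇒> j≰ }) ]′ (m≤n⇒m<n∨m≡n y≤sk)

  colLen-cut : ∀ {j m} → ColumnCut j n m → colLen n lam j ≡ m
  colLen-cut {j} (m≤n , reach , miss) rewrite interval≡applyUpTo 1 n =
    length-filter-applyUpTo (λ i → j ≤? lam i) suc m≤n
      (λ i i<m → reach (suc i) (s≤s z≤n) i<m) (λ i m≤i i<n → <⇒≱ (miss (suc i) (s≤s m≤i) i<n))

  inR⇒descent : ∀ {q} → InR q → 1 ≤ q × q < n × lam (suc q) < lam q
  inR⇒descent {q} r
    with (t₁ , t) ← Equivalence.to (T-∧ {⌊ 1 ≤? q ⌋}) r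
    with (t₂ , t₃) ← Equivalence.to (T-∧ {⌊ q <? n ⌋}) t
    with (j , j∈ , colLen≡q) ← find (any⁻ (λ j → ⌊ colLen n lam j ≟ q ⌋) (interval 1 (lam 1)) t₃)
    with (m , cut@(_ , reach , miss)) ← columnCut j n ≤-refl
    = 1≤q , q<n , <-≤-trans (miss (suc q) (s≤s (≤-reflexive m≡q)) q<n) (reach q 1≤q (≤-reflexive (sym m≡q)))
    where
    1≤q : 1 ≤ q
    1≤q = toWitness {a? = 1 ≤? q} t₁
    q<n : q < n
    q<n = toWitness {a? = q <? n} t₂
    m≡q : m ≡ q
    m≡q = trans (sym (colLen-cut cut)) (toWitness {a? = colLen n lam j ≟ q} colLen≡q)

  descent⇒inR : ∀ {q} → 1 ≤ q → q < n → lam (suc q) < lam q → InR q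
  descent⇒inR {q} 1≤q q<n descent =
    Equivalence.from (T-∧ {⌊ 1 ≤? q ⌋}) (fromWitness 1≤q , Equivalence.from (T-∧ {⌊ q <? n ⌋}) (fromWitness q<n ,
      any⁺ (λ j → ⌊ colLen n lam j ≟ q ⌋)
        (lose (∈-interval⁺ (≤-trans (s≤s z≤n) descent) (lam-antitone ≤-refl 1≤q (<⇒≤ q<n))) (fromWitness cut))))
    where
    cut : colLen n lam (lam q) ≡ q
    cut = colLen-cut (<⇒≤ q<n , (λ y 1≤y y≤q → lam-antitone 1≤y y≤q (<⇒≤ q<n)) ,
                      λ y q<y y≤n → ≤-<-trans (lam-antitone (s≤s z≤n) q<y y≤n) descent)

module Carrels (n : ℕ) (lam : ℕ → ℕ) (P : IsPartition n lam) where
  open Partition n lam P public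

  top : ℕ → ℕ
  top = carrelTop n lam

  bot : ℕ → ℕ
  bot = carrelBot n lam

  UpperBoundary : ℕ → Set
  UpperBoundary t = t ≡ n ⊎ InR t

  LowerBoundary : ℕ → Set
  LowerBoundary b = b ≡ 0 ⊎ InR b

  IsTop : ℕ → ℕ → Set
  IsTop i t = i ≤ t × t ≤ n × UpperBoundary t × (∀ q → i ≤ q → q < t → ¬ InR q)

  IsBot : ℕ → ℕ → Set
  IsBot i b = b < i × LowerBoundary b × (∀ q → b < q → q < i → ¬ InR q)

  upperBoundary⇒inR : ∀ {t} → t < n → UpperBoundary t → InR t
  upperBoundary⇒inR t<n (inj₁ refl) = ⊥-elim (<-irrefl refl t<n)
  upperBoundary⇒inR _ (inj₂ r) = r

  lowerBoundary⇒inR : ∀ {b} → 1 ≤ b → LowerBoundary b → InR b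
  lowerBoundary⇒inR 1≤b (inj₁ refl) = ⊥-elim (<⇒≱ 1≤b z≤n)
  lowerBoundary⇒inR _ (inj₂ r) = r

  top-isTop : ∀ {i} → i ≤ n → IsTop i (top i)
  top-isTop {i} i≤n with findFirst (inR n lam) (interval i (n ∸ 1)) | findFirst-interval (inR n lam) i (n ∸ 1)
  ... | _ | none miss = i≤n , ≤-refl , inj₁ refl , λ q i≤q q<n → miss q i≤q (<⇒≤∸1 q<n)
  ... | _ | found i≤x _ hit earlier = i≤x , <⇒≤ (proj₁ (proj₂ (inR⇒descent hit))) , inj₂ hit , earlier

  isTop-unique : ∀ {i t t′} → IsTop i t → IsTop i t′ → t ≡ t′
  isTop-unique {t = t} {t′} (i≤t , t≤n , bt , gap) (i≤t′ , t′≤n , bt′ , gap′) with <-cmp t t′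
  ... | tri≈ _ t≡t′ _ = t≡t′
  ... | tri< t<t′ _ _ = ⊥-elim (gap′ t i≤t t<t′ (upperBoundary⇒inR (<-≤-trans t<t′ t′≤n) bt))
  ... | tri> _ _ t′<t = ⊥-elim (gap t′ i≤t′ t′<t (upperBoundary⇒inR (<-≤-trans t′<t t≤n) bt′))

  bot-isBot : ∀ {i} → 1 ≤ i → IsBot i (bot i)
  bot-isBot {i} 1≤i with findLast (inR n lam) (interval 1 (i ∸ 1)) | findLast-interval (inR n lam) 1 (i ∸ 1)
  ... | _ | none miss = 1≤i , inj₁ refl , λ q 0<q q<i → miss q 0<q (<⇒≤∸1 q<i)
  ... | _ | found 1≤x x≤ hit later = ≤∸1⇒< 1≤x x≤ , inj₂ hit , λ q x<q q<i → later q x<q (<⇒≤∸1 q<i)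

  isBot-unique : ∀ {i b b′} → IsBot i b → IsBot i b′ → b ≡ b′
  isBot-unique {b = b} {b′} (b<i , bb , gap) (b′<i , bb′ , gap′) with <-cmp b b′
  ... | tri≈ _ b≡b′ _ = b≡b′
  ... | tri< b<b′ _ _ = ⊥-elim (gap b′ b<b′ b′<i (lowerBoundary⇒inR (≤-trans (s≤s z≤n) b<b′) bb′))
  ... | tri> _ _ b′<b = ⊥-elim (gap′ b b′<b b<i (lowerBoundary⇒inR (≤-trans (s≤s z≤n) b′<b) bb))

  i≤top : ∀ {i} → i ≤ n → i ≤ top i
  i≤top i≤n = proj₁ (top-isTop i≤n)

  top≤n : ∀ {i} → i ≤ n → top i ≤ n
  top≤n i≤n = proj₁ (proj₂ (top-isTop i≤n))

  top-upperBoundary : ∀ {i} → i ≤ n → UpperBoundary (top i)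
  top-upperBoundary i≤n = proj₁ (proj₂ (proj₂ (top-isTop i≤n)))

  top-noInR : ∀ {i q} → i ≤ n → i ≤ q → q < top i → ¬ InR q
  top-noInR i≤n = proj₂ (proj₂ (proj₂ (top-isTop i≤n))) _

  bot<i : ∀ {i} → 1 ≤ i → bot i < i
  bot<i 1≤i = proj₁ (bot-isBot 1≤i)

  bot≤n : ∀ {i} → 1 ≤ i → i ≤ n → bot i ≤ n
  bot≤n 1≤i i≤n = ≤-trans (<⇒≤ (bot<i 1≤i)) i≤n

  bot-lowerBoundary : ∀ {i} → 1 ≤ i → LowerBoundary (bot i)
  bot-lowerBoundary 1≤i = proj₁ (proj₂ (bot-isBot 1≤i))

  inCarrel≤n : ∀ {i k} → i ≤ n → k ≤ top i → k ≤ n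
  inCarrel≤n i≤n k≤t = ≤-trans k≤t (top≤n i≤n)

  top-sameCarrel : ∀ {i k} → i ≤ k → k ≤ top i → k ≤ n → top k ≡ top i
  top-sameCarrel i≤k k≤t k≤n with top-isTop (≤-trans i≤k k≤n)
  ... | _ , t≤n , bt , gap = isTop-unique (top-isTop k≤n) (k≤t , t≤n , bt , λ q k≤q q<t → gap q (≤-trans i≤k k≤q) q<t)

  top≤inR : ∀ {i q} → i ≤ n → InR q → i ≤ q → top i ≤ q
  top≤inR i≤n r i≤q = ≮⇒≥ λ q<t → top-noInR i≤n i≤q q<t r

  top-upperBoundary-self : ∀ {t} → t ≤ n → UpperBoundary t → top t ≡ t
  top-upperBoundary-self t≤n bt = isTop-unique (top-isTop t≤n) (≤-refl , t≤n , bt , λ q t≤q q<t → ⊥-elim (<⇒≱ q<t t≤q))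

  inR≤bot : ∀ {i s} → 1 ≤ i → InR s → s < i → s ≤ bot i
  inR≤bot 1≤i r s<i = ≮⇒≥ λ b<s → proj₂ (proj₂ (bot-isBot 1≤i)) _ b<s s<i r

  bot-top : ∀ {i} → 1 ≤ i → i ≤ n → bot (top i) ≡ bot i
  bot-top {i} 1≤i i≤n with bot-isBot 1≤i | top-isTop i≤n
  ... | b<i , bb , gap | i≤t , _ , _ , gap′ =
    isBot-unique (bot-isBot (≤-trans 1≤i i≤t)) (<-≤-trans b<i i≤t , bb , between)
    where
    between : ∀ q → bot i < q → q < top i → ¬ InR q
    between q b<q q<t with <-cmp q i
    ... | tri< q<i _ _ = gap q b<q q<i
    ... | tri≈ _ refl _ = gap′ q ≤-refl q<t
    ... | tri> _ _ i<q = gap′ q (<⇒≤ i<q) q<t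

  top-inCarrel : ∀ {t x} → t ≤ n → UpperBoundary t → 1 ≤ t → bot t < x → x ≤ t → top x ≡ t
  top-inCarrel t≤n bt 1≤t b<x x≤t with bot-isBot 1≤t
  ... | _ , _ , gap = isTop-unique (top-isTop (≤-trans x≤t t≤n)) (x≤t , t≤n , bt , λ q x≤q q<t → gap q (<-≤-trans b<x x≤q) q<t)

  top-sameBot : ∀ {i x} → 1 ≤ i → i ≤ n → bot i < x → x ≤ top i → top x ≡ top i
  top-sameBot 1≤i i≤n b<x x≤t =
    top-inCarrel (top≤n i≤n) (top-upperBoundary i≤n) (≤-trans 1≤i (i≤top i≤n)) (subst (_< _) (sym (bot-top 1≤i i≤n)) b<x) x≤t

  bot-sameCarrel : ∀ {i k} → 1 ≤ i → i ≤ k → k ≤ top i → k ≤ n → bot k ≡ bot i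
  bot-sameCarrel 1≤i i≤k k≤t k≤n =
    trans (sym (bot-top (≤-trans 1≤i i≤k) k≤n)) (trans (cong bot (top-sameCarrel i≤k k≤t k≤n)) (bot-top 1≤i (≤-trans i≤k k≤n)))

  bot-top<i : ∀ {x} → 1 ≤ x → x ≤ n → bot (top x) < x
  bot-top<i 1≤x x≤n = subst (_< _) (sym (bot-top 1≤x x≤n)) (bot<i 1≤x)

  top≤bot : ∀ {i k} → i ≤ n → k ≤ n → 1 ≤ k → top i < k → top i ≤ bot k
  top≤bot i≤n k≤n 1≤k t<k = inR≤bot 1≤k (upperBoundary⇒inR (<-≤-trans t<k k≤n) (top-upperBoundary i≤n)) t<k

  lam-constant : ∀ {i k} → 1 ≤ i → i ≤ k → k ≤ top i → k ≤ n → lam k ≡ lam i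
  lam-constant {i} {k} 1≤i i≤k k≤t k≤n with m≤n⇒m<n∨m≡n i≤k
  ... | inj₂ refl = refl
  ... | inj₁ i<k with k | i<k
  ...   | suc k′ | s≤s i≤k′ =
    ≤-antisym (lam-antitone 1≤i (m≤n⇒m≤1+n i≤k′) k≤n)
              (≤-trans (≤-reflexive (sym (lam-constant 1≤i i≤k′ (m≤n⇒m≤1+n′ k≤t) (m≤n⇒m≤1+n′ k≤n))))
                       (≮⇒≥ noDescent))
    where
    m≤n⇒m≤1+n′ : ∀ {m o} → suc m ≤ o → m ≤ o
    m≤n⇒m≤1+n′ = ≤-trans (n≤1+n _)
    noDescent : ¬ lam (suc k′) < lam k′
    noDescent d = top-noInR (≤-trans (m≤n⇒m≤1+n i≤k′) k≤n) i≤k′ k≤t (descent⇒inR (≤-trans 1≤i i≤k′) k≤n d)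

  lam-descent-after-top : ∀ {i} → 1 ≤ i → i ≤ n → top i < n → lam (suc (top i)) < lam i
  lam-descent-after-top {i} 1≤i i≤n t<n = subst (lam (suc (top i)) <_) (lam-constant 1≤i (i≤top i≤n) ≤-refl (top≤n i≤n))
    (proj₂ (proj₂ (inR⇒descent (upperBoundary⇒inR t<n (top-upperBoundary i≤n)))))

  empty-row⇒top≡n : ∀ {i} → 1 ≤ i → i ≤ n → lam i ≡ 0 → top i ≡ n
  empty-row⇒top≡n {i} 1≤i i≤n lam≡0 with m≤n⇒m<n∨m≡n (top≤n i≤n)
  ... | inj₂ t≡n = t≡n
  ... | inj₁ t<n = ⊥-elim (<⇒≱ (subst (lam (suc (top i)) <_) lam≡0 (lam-descent-after-top 1≤i i≤n t<n)) z≤n)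

StrictMinUpTo : (ℕ → ℕ) → ℕ → ℕ → Set
StrictMinUpTo β x y = ∀ k → x < k → k ≤ y → (β x , x) <ᵈ (β k , k)

strictMinUpTo-trans : ∀ {β z y x} → z < y → StrictMinUpTo β z y → StrictMinUpTo β y x → StrictMinUpTo β z x
strictMinUpTo-trans {y = y} z<y zy yx k z<k k≤x with ≤-<-connex k y
... | inj₁ k≤y = zy k z<k k≤y
... | inj₂ y<k = <ᵈ-≤ᵈ-trans (zy y z<y ≤-refl) (<ᵈ⇒≤ᵈ (yx k y<k k≤x))

private
  test⇒<ᵈ : ∀ (β : ℕ → ℕ) x y → T ⌊ x + β y <? β x + y ⌋ → (β y , y) <ᵈ (β x , x)
  test⇒<ᵈ β x y t = diff< (subst (_< β x + y) (+-comm x (β y)) (toWitness {a? = x + β y <? β x + y} t))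

  ¬test⇒≤ᵈ : ∀ (β : ℕ → ℕ) x y → ¬ T ⌊ x + β y <? β x + y ⌋ → (β x , x) ≤ᵈ (β y , y)
  ¬test⇒≤ᵈ β x y ¬t = diff≤ (subst (β x + y ≤_) (+-comm x (β y)) (≮⇒≥ (¬t ∘ fromWitness {a? = x + β y <? β x + y})))

  chainStep : ∀ {β a x y} → suc a ≤ y → y ≤ x ∸ 1 → T ⌊ x + β y <? β x + y ⌋ →
    (∀ k → y < k → k ≤ x ∸ 1 → ¬ T ⌊ x + β k <? β x + k ⌋) → y < x × StrictMinUpTo β y x
  chainStep {β} {a} {x} {y} a<y y≤x∸1 hit later = y<x , strictMin
    where
    y<x : y < x
    y<x = ≤∸1⇒< (≤-trans (s≤s z≤n) a<y) y≤x∸1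
    strictMin : StrictMinUpTo β y x
    strictMin k y<k k≤x with m≤n⇒m<n∨m≡n k≤x
    ... | inj₂ refl = test⇒<ᵈ β x y hit
    ... | inj₁ k<x = <ᵈ-≤ᵈ-trans (test⇒<ᵈ β x y hit) (¬test⇒≤ᵈ β x k (later k y<k (<⇒≤∸1 k<x)))

  fuel-step : ∀ {x y a f} → y ≤ x ∸ 1 → x ≤ suc (a + suc f) → y ≤ suc (a + f)
  fuel-step {a = a} {f} y≤x∸1 x≤ = ≤-trans y≤x∸1 (≤-trans (∸-monoˡ-≤ 1 x≤) (≤-reflexive (+-suc a f)))

critChain-sound : ∀ β a x f {z} → x ≤ suc (a + f) → z ∈ critChain β a x f →
  z ≡ x ⊎ (a < z × z < x × StrictMinUpTo β z x)
critChain-sound β a x zero _ (here refl) = inj₁ refl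
critChain-sound β a x (suc f) x≤ z∈
  with findLast (λ y → ⌊ x + β y <? β x + y ⌋) (interval (suc a) (x ∸ 1))
     | findLast-interval (λ y → ⌊ x + β y <? β x + y ⌋) (suc a) (x ∸ 1)
critChain-sound β a x (suc f) x≤ (here refl) | nothing | _ = inj₁ refl
critChain-sound β a x (suc f) x≤ (here refl) | just y | _ = inj₁ refl
critChain-sound β a x (suc f) x≤ (there z∈) | just y | found a<y y≤x∸1 hit later
  with y<x , yx ← chainStep {β} a<y y≤x∸1 hit later
  with critChain-sound β a y f (fuel-step y≤x∸1 x≤) z∈
... | inj₁ refl = inj₂ (a<y , y<x , yx)
... | inj₂ (a<z , z<y , zy) = inj₂ (a<z , <-trans z<y y<x , strictMinUpTo-trans z<y zy yx)

critChain-complete : ∀ β a x f {z} → x ≤ suc (a + f) →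
  z ≡ x ⊎ (a < z × z < x × StrictMinUpTo β z x) → z ∈ critChain β a x f
critChain-complete β a x zero _ (inj₁ refl) = here refl
critChain-complete β a x zero x≤ (inj₂ (a<z , z<x , _)) =
  ⊥-elim (<⇒≱ (<-≤-trans z<x (≤-trans x≤ (≤-reflexive (cong suc (+-identityʳ a))))) a<z)
critChain-complete β a x (suc f) x≤ z≡
  with findLast (λ y → ⌊ x + β y <? β x + y ⌋) (interval (suc a) (x ∸ 1))
     | findLast-interval (λ y → ⌊ x + β y <? β x + y ⌋) (suc a) (x ∸ 1)
critChain-complete β a x (suc f) x≤ (inj₁ refl) | nothing | _ = here refl
critChain-complete β a x (suc f) x≤ (inj₁ refl) | just y | _ = here refl
critChain-complete β a x (suc f) {z} x≤ (inj₂ (a<z , z<x , zx)) | nothing | none miss =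
  ⊥-elim (<ᵈ⇒≱ᵈ (zx x z<x ≤-refl) (¬test⇒≤ᵈ β x z (miss z a<z (<⇒≤∸1 z<x))))
critChain-complete β a x (suc f) {z} x≤ (inj₂ (a<z , z<x , zx)) | just y | found a<y y≤x∸1 hit later
  with <-cmp z y
... | tri≈ _ refl _ = there (critChain-complete β a y f (fuel-step y≤x∸1 x≤) (inj₁ refl))
... | tri< z<y _ _ = there (critChain-complete β a y f (fuel-step y≤x∸1 x≤)
        (inj₂ (a<z , z<y , λ k z<k k≤y → zx k z<k (≤-trans k≤y (≤-trans y≤x∸1 (m∸n≤m x 1))))))
... | tri> _ _ y<z = ⊥-elim (<ᵈ⇒≱ᵈ (zx x z<x ≤-refl) (¬test⇒≤ᵈ β x z (later z y<z (<⇒≤∸1 z<x))))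

module CriticalIndices (n : ℕ) (lam : ℕ → ℕ) (P : IsPartition n lam) (1≤n : 1 ≤ n) where
  open Carrels n lam P public

  Critical : (ℕ → ℕ) → ℕ → Set
  Critical β x = 1 ≤ x × x ≤ n × StrictMinUpTo β x (top x)

  private
    inRs : List ℕ
    inRs = filter (λ q → T? (inR n lam q)) (interval 1 (n ∸ 1))

    ∈carrelTops⁻ : ∀ {t} → t ∈ carrelTops n lam → t ≤ n × UpperBoundary t × 1 ≤ t
    ∈carrelTops⁻ t∈ with ∈-++⁻ inRs t∈
    ... | inj₂ (here refl) = ≤-refl , inj₁ refl , 1≤n
    ... | inj₁ t∈inRs with _ , r ← ∈-filter⁻ (λ q → T? (inR n lam q)) {xs = interval 1 (n ∸ 1)} t∈inRs
                      with 1≤t , t<n , _ ← inR⇒descent r = <⇒≤ t<n , inj₂ r , 1≤t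

    ∈carrelTops⁺ : ∀ {t} → UpperBoundary t → t ∈ carrelTops n lam
    ∈carrelTops⁺ (inj₁ refl) = ∈-++⁺ʳ inRs (here refl)
    ∈carrelTops⁺ (inj₂ r) with 1≤t , t<n , _ ← inR⇒descent r =
      ∈-++⁺ˡ (∈-filter⁺ (λ q → T? (inR n lam q)) (∈-interval⁺ 1≤t (<⇒≤∸1 t<n)) r)

    fuel : ∀ t → t ≤ n → t ≤ suc (bot t + n)
    fuel t t≤n = ≤-trans t≤n (≤-trans (m≤n+m n (bot t)) (n≤1+n _))

  isCritical⇒critical : ∀ {β x} → IsCritical n lam β x → Critical β x
  isCritical⇒critical {β} {x} c
    with (t , t∈ , x∈) ← find (∈-concatMap⁻ (λ b → critChain β (bot b) b n) {xs = carrelTops n lam} (elemB⁻ c))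
    with t≤n , bt , 1≤t ← ∈carrelTops⁻ t∈
    with critChain-sound β (bot t) t n (fuel t t≤n) x∈
  ... | inj₁ refl = 1≤t , t≤n , λ k x<k k≤tx → ⊥-elim (<⇒≱ x<k (subst (k ≤_) (top-upperBoundary-self t≤n bt) k≤tx))
  ... | inj₂ (b<x , x<t , xt) = ≤-trans (s≤s z≤n) b<x , ≤-trans (<⇒≤ x<t) t≤n ,
          subst (StrictMinUpTo β x) (sym (top-inCarrel t≤n bt 1≤t b<x (<⇒≤ x<t))) xt

  critical⇒isCritical : ∀ {β x} → Critical β x → IsCritical n lam β x
  critical⇒isCritical {β} {x} (1≤x , x≤n , xt) =
    elemB⁺ (∈-concatMap⁺ (λ b → critChain β (bot b) b n) {xs = carrelTops n lam}
      (lose (∈carrelTops⁺ (top-upperBoundary x≤n))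
            (critChain-complete β (bot (top x)) (top x) n (fuel (top x) (top≤n x≤n)) position)))
    where
    position : x ≡ top x ⊎ (bot (top x) < x × x < top x × StrictMinUpTo β x (top x))
    position with m≤n⇒m<n∨m≡n (i≤top x≤n)
    ... | inj₂ x≡t = inj₁ x≡t
    ... | inj₁ x<t = inj₂ (bot-top<i 1≤x x≤n , x<t , xt)

module Cores (n : ℕ) (lam : ℕ → ℕ) (P : IsPartition n lam) (1≤n : 1 ≤ n) where
  open CriticalIndices n lam P 1≤n public

  MinimalFrom : (ℕ → ℕ) → ℕ → ℕ → Set
  MinimalFrom β y c = ∀ k → y ≤ k → k ≤ top y → (β c , c) ≤ᵈ (β k , k)

  -- the rightmost minimiser of k ↦ β k − k on [y , top y] is critical
  criticalMinimiser : ∀ β {y} → 1 ≤ y → y ≤ n → ∃ λ c → y ≤ c × c ≤ top y × Critical β c × MinimalFrom β y c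
  criticalMinimiser β {y} 1≤y y≤n = go (top y ∸ y) 1≤y y≤n (m+[n∸m]≡n (i≤top y≤n))
    where
    belowTop : ∀ {y d} → y ≤ n → y + suc d ≡ top y → y < top y × suc y ≤ n × top (suc y) ≡ top y
    belowTop {y} {d} y≤n y+d≡t = y<t , sy≤n , top-sameCarrel (n≤1+n y) y<t sy≤n
      where
      y<t : y < top y
      y<t = subst (y <_) y+d≡t (subst (_≤ y + suc d) (+-comm y 1) (+-monoʳ-≤ y (s≤s z≤n)))
      sy≤n : suc y ≤ n
      sy≤n = inCarrel≤n y≤n y<t

    go : ∀ d {y} → 1 ≤ y → y ≤ n → y + d ≡ top y → ∃ λ c → y ≤ c × c ≤ top y × Critical β c × MinimalFrom β y c
    go zero {y} 1≤y y≤n y≡t =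
      y , ≤-refl , ≤-reflexive y≡t′ , (1≤y , y≤n , λ k y<k k≤t → ⊥-elim (<⇒≱ y<k (subst (k ≤_) (sym y≡t′) k≤t))) ,
      λ k y≤k k≤t → ≤ᵈ-reflexive-at (≤-antisym (subst (k ≤_) (sym y≡t′) k≤t) y≤k)
      where
      y≡t′ : y ≡ top y
      y≡t′ = trans (sym (+-identityʳ y)) y≡t
      ≤ᵈ-reflexive-at : ∀ {k} → k ≡ y → (β y , y) ≤ᵈ (β k , k)
      ≤ᵈ-reflexive-at refl = ≤ᵈ-refl
    go (suc d) {y} 1≤y y≤n y+d≡t
      with y<t , sy≤n , same ← belowTop y≤n y+d≡t
      with c , sy≤c , c≤t , critical-c , minimal-c ← go d (s≤s z≤n) sy≤n (trans (sym (+-suc y d)) (trans y+d≡t (sym same)))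
      with β y + c <? β c + y
    ... | yes y<ᵈc = y , ≤-refl , <⇒≤ y<t , (1≤y , y≤n , strict) , λ k y≤k k≤t →
                       [ (λ y<k → <ᵈ⇒≤ᵈ (strict k y<k k≤t)) , (λ { refl → ≤ᵈ-refl }) ]′ (m≤n⇒m<n∨m≡n y≤k)
      where
      strict : StrictMinUpTo β y (top y)
      strict k y<k k≤t = <ᵈ-≤ᵈ-trans (diff< y<ᵈc) (minimal-c k y<k (subst (k ≤_) (sym same) k≤t))
    ... | no y≮ᵈc = c , <⇒≤ sy≤c , subst (c ≤_) same c≤t , critical-c , λ k y≤k k≤t →
                      [ (λ y<k → minimal-c k y<k (subst (k ≤_) (sym same) k≤t)) , (λ { refl → diff≤ (≮⇒≥ y≮ᵈc) }) ]′
                        (m≤n⇒m<n∨m≡n y≤k)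

  NextCritical : (ℕ → ℕ) → ℕ → ℕ → Set
  NextCritical β i x = i ≤ x × x ≤ top i × Critical β x × MinimalFrom β i x × (∀ y → i ≤ y → y < x → ¬ IsCritical n lam β y)

  nextCrit-spec : ∀ β {i} → 1 ≤ i → i ≤ n → NextCritical β i (nextCrit n lam β i)
  nextCrit-spec β {i} 1≤i i≤n
    with c , i≤c , c≤t , critical-c , minimal-c ← criticalMinimiser β 1≤i i≤n
    with findFirst (isCrit n lam β) (interval i (top i)) | findFirst-interval (isCrit n lam β) i (top i)
  ... | _ | none miss = ⊥-elim (miss c i≤c c≤t (critical⇒isCritical critical-c))
  ... | _ | found {x} i≤x x≤t hit earlier = i≤x , x≤t , isCritical⇒critical hit , minimal , earlier
    where
    minimal : MinimalFrom β i x
    minimal k i≤k k≤t with <-cmp x c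
    ... | tri≈ _ refl _ = minimal-c k i≤k k≤t
    ... | tri> _ _ c<x = ⊥-elim (earlier c i≤c c<x (critical⇒isCritical critical-c))
    ... | tri< x<c _ _ = <ᵈ⇒≤ᵈ (<ᵈ-≤ᵈ-trans
          (proj₂ (proj₂ (isCritical⇒critical hit)) c x<c (subst (c ≤_) (sym (top-sameCarrel i≤x x≤t (inCarrel≤n i≤n x≤t))) c≤t))
          (minimal-c k i≤k k≤t))

  CoreValue : (ℕ → ℕ) → ℕ → ℕ → Set
  CoreValue β i c = (∀ k → i ≤ k → k ≤ top i → (c , i) ≤ᵈ (β k , k)) ×
                    (∃ λ k → i ≤ k × k ≤ top i × (β k , k) ≤ᵈ (c , i))

  coreValue-unique : ∀ {β i c c′} → CoreValue β i c → CoreValue β i c′ → c ≡ c′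
  coreValue-unique (below , k , i≤k , k≤t , attained) (below′ , k′ , i≤k′ , k′≤t , attained′) =
    ≤-antisym (≤ᵈ⇒≤ (≤ᵈ-trans (below k′ i≤k′ k′≤t) attained′))
              (≤ᵈ⇒≤ (≤ᵈ-trans (below′ k i≤k k≤t) attained))

  coreValue : ∀ {β i} → IsUpperB n β → 1 ≤ i → i ≤ n → CoreValue β i (core n lam β i)
  coreValue {β} {i} up 1≤i i≤n with i≤x , x≤t , (1≤x , x≤n , _) , minimal , _ ← nextCrit-spec β 1≤i i≤n =
    (λ k i≤k k≤t → ≤ᵈ-trans (diff≤ (≤-reflexive shift)) (minimal k i≤k k≤t)) ,
    _ , i≤x , x≤t , diff≤ (≤-reflexive (sym shift))
    where
    x : ℕ
    x = nextCrit n lam β i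
    shift : β x ∸ (x ∸ i) + x ≡ β x + i
    shift = m∸[n∸o]+n≡m+o i≤x (≤-trans (m∸n≤m x i) (up x 1≤x x≤n))

  module _ {β : ℕ → ℕ} (up : IsUpperB n β) where

    private
      e : ℕ → ℕ
      e = core n lam β

    core≤ : ∀ {i} → 1 ≤ i → i ≤ n → e i ≤ β i
    core≤ 1≤i i≤n = ≤ᵈ⇒≤ (proj₁ (coreValue up 1≤i i≤n) _ ≤-refl (i≤top i≤n))

    ≤core : ∀ {i} → 1 ≤ i → i ≤ n → i ≤ e i
    ≤core {i} 1≤i i≤n =
      let _ , k , i≤k , k≤t , attained = coreValue up 1≤i i≤n in
      ≤ᵈ⇒≤ (≤ᵈ-trans (diagonal-≤ᵈ i k)
                     (≤ᵈ-trans (≤⇒≤ᵈ (up k (≤-trans 1≤i i≤k) (inCarrel≤n i≤n k≤t))) attained))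

    core-upper : IsUpperB n e
    core-upper _ = ≤core

    core-slope : ∀ {i k} → 1 ≤ i → i ≤ k → k ≤ top i → k ≤ n → (e i , i) ≤ᵈ (e k , k)
    core-slope {i} {k} 1≤i i≤k k≤t k≤n =
      let _ , k′ , k≤k′ , k′≤tk , attained = coreValue up (≤-trans 1≤i i≤k) k≤n in
      ≤ᵈ-trans (proj₁ (coreValue up 1≤i (≤-trans i≤k k≤n)) k′ (≤-trans i≤k k≤k′)
                      (subst (k′ ≤_) (top-sameCarrel i≤k k≤t k≤n) k′≤tk))
               attained

    critical⇒core≡ : ∀ {x} → Critical β x → e x ≡ β x
    critical⇒core≡ {x} (1≤x , x≤n , strict) = coreValue-unique (coreValue up 1≤x x≤n)
      ((λ k x≤k k≤t → [ (λ x<k → <ᵈ⇒≤ᵈ (strict k x<k k≤t)) , (λ { refl → ≤ᵈ-refl }) ]′ (m≤n⇒m<n∨m≡n x≤k)) ,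
       x , ≤-refl , i≤top x≤n , ≤ᵈ-refl)

    critical⇒critical-core : ∀ {x} → Critical β x → Critical e x
    critical⇒critical-core {x} c@(1≤x , x≤n , strict) = 1≤x , x≤n , λ k x<k k≤t → strict′ k x<k k≤t
      where
      strict′ : StrictMinUpTo e x (top x)
      strict′ k x<k k≤t =
        let _ , k′ , k≤k′ , k′≤tk , attained = coreValue up (≤-trans 1≤x (<⇒≤ x<k)) (inCarrel≤n x≤n k≤t) in
        subst (λ v → (v , x) <ᵈ (e k , k)) (sym (critical⇒core≡ c))
          (<ᵈ-≤ᵈ-trans (strict k′ (<-≤-trans x<k k≤k′)
                               (subst (k′ ≤_) (top-sameCarrel (<⇒≤ x<k) k≤t (inCarrel≤n x≤n k≤t)) k′≤tk))
                       attained)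

    critical-core⇒critical : ∀ {x} → Critical e x → Critical β x
    critical-core⇒critical {x} (1≤x , x≤n , strict) = viaWitness (proj₂ (coreValue up 1≤x x≤n))
      where
      viaWitness : (∃ λ k → x ≤ k × k ≤ top x × (β k , k) ≤ᵈ (e x , x)) → Critical β x
      viaWitness (k′ , x≤k′ , k′≤t , attained) with m≤n⇒m<n∨m≡n x≤k′
      ... | inj₁ x<k′ = ⊥-elim (<ᵈ⇒≱ᵈ (strict k′ x<k′ k′≤t)
                                      (≤ᵈ-trans (≤⇒≤ᵈ (core≤ (≤-trans 1≤x x≤k′) (inCarrel≤n x≤n k′≤t))) attained))
      ... | inj₂ refl = 1≤x , x≤n , λ k x<k k≤t →
        <ᵈ-≤ᵈ-trans (≤ᵈ-<ᵈ-trans attained (strict k x<k k≤t))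
                    (≤⇒≤ᵈ (core≤ (≤-trans 1≤x (<⇒≤ x<k)) (inCarrel≤n x≤n k≤t)))

    core-idem : core n lam e ≈[ n ] e
    core-idem i 1≤i i≤n = coreValue-unique (coreValue core-upper 1≤i i≤n)
      ((λ k i≤k k≤t → core-slope 1≤i i≤k k≤t (inCarrel≤n i≤n k≤t)) , i , ≤-refl , i≤top i≤n , ≤ᵈ-refl)

  core-cong : ∀ {β β′} → IsUpperB n β → IsUpperB n β′ → β ≈[ n ] β′ → core n lam β ≈[ n ] core n lam β′
  core-cong {β} {β′} up up′ β≈β′ i 1≤i i≤n =
    let below , k , i≤k , k≤t , attained = coreValue up 1≤i i≤n in
    coreValue-unique ((λ k′ i≤k′ k′≤t → subst (λ v → (_ , i) ≤ᵈ (v , k′)) (same i≤k′ k′≤t) (below k′ i≤k′ k′≤t)) ,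
                      k , i≤k , k≤t , subst (λ v → (v , k) ≤ᵈ (_ , i)) (same i≤k k≤t) attained)
                     (coreValue up′ 1≤i i≤n)
    where
    same : ∀ {k} → i ≤ k → k ≤ top i → β k ≡ β′ k
    same i≤k k≤t = β≈β′ _ (≤-trans 1≤i i≤k) (inCarrel≤n i≤n k≤t)

sim-sym : ∀ {n lam β β′} → Sim n lam β β′ → Sim n lam β′ β
sim-sym sim T′ = swap (sim T′)

module Tableaux (n : ℕ) (lam : ℕ → ℕ) (P : IsPartition n lam) (1≤n : 1 ≤ n) where
  open Cores n lam P 1≤n public

  box-inCarrel : ∀ {j i k} → Box n lam j i → i ≤ k → k ≤ top i → k ≤ n → Box n lam j k
  box-inCarrel (1≤i , i≤n , 1≤j , j≤lam) i≤k k≤t k≤n =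
    ≤-trans 1≤i i≤k , k≤n , 1≤j , subst (_ ≤_) (sym (lam-constant 1≤i i≤k k≤t k≤n)) j≤lam

  -- Within a carrel all rows have the same length, so a column strictly increases down the whole carrel.
  column-slope : ∀ {T′ j i k} → IsSSYT n lam T′ → Box n lam j i → i ≤ k → k ≤ top i → k ≤ n →
    (T′ j i , i) ≤ᵈ (T′ j k , k)
  column-slope {T′} {j} {i} {k} (_ , _ , column) bx i≤k k≤t k≤n = stepwise-<⇒≤ᵈ (T′ j) i≤k λ m i≤m m<k →
    column j m (box-inCarrel bx i≤m (≤-trans (<⇒≤ m<k) k≤t) (≤-trans (<⇒≤ m<k) k≤n))
               (box-inCarrel bx (≤-trans i≤m (n≤1+n m)) (≤-trans m<k k≤t) (≤-trans m<k k≤n))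

  inS⇒≤core : ∀ {β T′ j i} → IsUpperB n β → InS n lam β T′ → Box n lam j i → T′ j i ≤ core n lam β i
  inS⇒≤core {β} {T′} {j} {i} up (ssyt , bounded) bx@(1≤i , i≤n , _) =
    let _ , k , i≤k , k≤t , attained = coreValue up 1≤i i≤n
        k≤n = inCarrel≤n i≤n k≤t in
    ≤ᵈ⇒≤ (≤ᵈ-trans (column-slope ssyt bx i≤k k≤t k≤n)
                   (≤ᵈ-trans (≤⇒≤ᵈ (bounded j k (box-inCarrel bx i≤k k≤t k≤n))) attained))

  core-emptyRow : ∀ {β i} → U n lam β → 1 ≤ i → i ≤ n → lam i ≡ 0 → core n lam β i ≡ i
  core-emptyRow {β} {i} (tuple , up) 1≤i i≤n lam≡0 = ≤-antisym
    (≤ᵈ⇒≤ (≤ᵈ-trans (proj₁ (coreValue up 1≤i i≤n) n i≤n (≤-reflexive (sym (empty-row⇒top≡n 1≤i i≤n lam≡0))))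
                    (≤ᵈ-trans (≤⇒≤ᵈ (proj₂ (tuple n 1≤n ≤-refl))) (diagonal-≤ᵈ n i))))
    (≤core up 1≤i i≤n)

  -- A tableau of 𝒮_λ(β) whose box (lam i , i) holds the core value at i: in the columns that end
  -- inside the carrel of i, the rows of that carrel carry the core, every other box k holds k.
  module Witness {β : ℕ → ℕ} (u : U n lam β) {i : ℕ} (1≤i : 1 ≤ i) (i≤n : i ≤ n) where

    private
      up : IsUpperB n β
      up = proj₂ u
      e : ℕ → ℕ
      e = core n lam β

    InBlock : ℕ → ℕ → Set
    InBlock j k = bot i < k × k ≤ top i × (top i ≡ n ⊎ lam (suc (top i)) < j)

    inBlock? : ∀ j k → Dec (InBlock j k)
    inBlock? j k = (bot i <? k) ×-dec ((k ≤? top i) ×-dec ((top i ≟ n) ⊎-dec (lam (suc (top i)) <? j)))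

    W : ℕ → ℕ → ℕ
    W j k with inBlock? j k
    ... | yes _ = e k
    ... | no _ = k

    W-ssyt : IsSSYT n lam W
    W-ssyt = entries , rows , columns
      where
      entries : ∀ j k → Box n lam j k → 1 ≤ W j k × W j k ≤ n
      entries j k (1≤k , k≤n , _) with inBlock? j k
      ... | yes _ = ≤-trans 1≤k (≤core up 1≤k k≤n) , ≤-trans (core≤ up 1≤k k≤n) (proj₂ (proj₁ u k 1≤k k≤n))
      ... | no _ = 1≤k , k≤n
      rows : ∀ j k → Box n lam j k → Box n lam (suc j) k → W j k ≤ W (suc j) k
      rows j k (1≤k , k≤n , _) _ with inBlock? j k | inBlock? (suc j) k
      ... | yes _ | yes _ = ≤-refl
      ... | no _ | yes _ = ≤core up 1≤k k≤n
      ... | no _ | no _ = ≤-refl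
      ... | yes (b<k , k≤t , short) | no out = ⊥-elim (out (b<k , k≤t , map₂ (λ l<j → ≤-trans l<j (n≤1+n j)) short))
      columns : ∀ j k → Box n lam j k → Box n lam j (suc k) → W j k < W j (suc k)
      columns j k (1≤k , k≤n , _) (_ , sk≤n , _ , j≤lam) with inBlock? j k | inBlock? j (suc k)
      ... | yes (b<k , k≤t , _) | yes (_ , sk≤t , _) =
        ≤ᵈ-<⇒< (core-slope up 1≤k (n≤1+n k) (subst (suc k ≤_) (sym (top-sameBot 1≤i i≤n b<k k≤t)) sk≤t) sk≤n) ≤-refl
      ... | no _ | yes _ = ≤core up (s≤s z≤n) sk≤n
      ... | no _ | no _ = ≤-refl
      ... | yes (b<k , k≤t , short) | no out with m≤n⇒m<n∨m≡n k≤t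
      ...   | inj₁ k<t = ⊥-elim (out (≤-trans b<k (n≤1+n k) , k<t , short))
      ...   | inj₂ refl with short
      ...     | inj₁ t≡n = ⊥-elim (<⇒≱ sk≤n (≤-reflexive (sym t≡n)))
      ...     | inj₂ l<j = ⊥-elim (<⇒≱ l<j j≤lam)

    W-bounded : ∀ j k → Box n lam j k → W j k ≤ β k
    W-bounded j k (1≤k , k≤n , _) with inBlock? j k
    ... | yes _ = core≤ up 1≤k k≤n
    ... | no _ = up k 1≤k k≤n

    W-corner : W (lam i) i ≡ e i
    W-corner with inBlock? (lam i) i
    ... | yes _ = refl
    ... | no out = ⊥-elim (out (bot<i 1≤i , i≤top i≤n , short))
      where
      short : top i ≡ n ⊎ lam (suc (top i)) < lam i
      short with m≤n⇒m<n∨m≡n (top≤n i≤n)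
      ... | inj₂ t≡n = inj₁ t≡n
      ... | inj₁ t<n = inj₂ (lam-descent-after-top 1≤i i≤n t<n)

  inS⇒core≤core : ∀ {β β′} → U n lam β → U n lam β′ → (∀ T′ → InS n lam β T′ → InS n lam β′ T′) →
    ∀ i → 1 ≤ i → i ≤ n → core n lam β i ≤ core n lam β′ i
  inS⇒core≤core {β} {β′} u u′ ⊆ i 1≤i i≤n with lam i ≟ 0
  ... | yes lam≡0 = ≤-reflexive (trans (core-emptyRow u 1≤i i≤n lam≡0) (sym (core-emptyRow u′ 1≤i i≤n lam≡0)))
  ... | no lam≢0 = subst (_≤ core n lam β′ i) W-corner
        (inS⇒≤core (proj₂ u′) (⊆ W (W-ssyt , W-bounded)) (1≤i , i≤n , n≢0⇒n>0 lam≢0 , ≤-refl))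
    where open Witness u 1≤i i≤n

  sim⇒core≈ : ∀ {β β′} → U n lam β → U n lam β′ → Sim n lam β β′ → core n lam β ≈[ n ] core n lam β′
  sim⇒core≈ u u′ sim i 1≤i i≤n =
    ≤-antisym (inS⇒core≤core u u′ (λ T′ → proj₁ (sim T′)) i 1≤i i≤n)
              (inS⇒core≤core u′ u (λ T′ → proj₂ (sim T′)) i 1≤i i≤n)

  core≈⇒inS : ∀ {β β′ T′} → IsUpperB n β → IsUpperB n β′ → core n lam β ≈[ n ] core n lam β′ →
    InS n lam β T′ → InS n lam β′ T′
  core≈⇒inS up up′ core≈ inS@(ssyt , _) = ssyt , λ j i bx@(1≤i , i≤n , _) →
    ≤-trans (inS⇒≤core up inS bx) (≤-trans (≤-reflexive (core≈ i 1≤i i≤n)) (core≤ up′ 1≤i i≤n))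

  core≈⇒sim : ∀ {β β′} → IsUpperB n β → IsUpperB n β′ → core n lam β ≈[ n ] core n lam β′ → Sim n lam β β′
  core≈⇒sim up up′ core≈ T′ = core≈⇒inS up up′ core≈ , core≈⇒inS up′ up (λ i 1≤i i≤n → sym (core≈ i 1≤i i≤n))

module Representatives (n : ℕ) (lam : ℕ → ℕ) (P : IsPartition n lam) (1≤n : 1 ≤ n) where
  open Tableaux n lam P 1≤n public

  U-core : ∀ {β} → U n lam β → U n lam (core n lam β)
  U-core (tuple , up) =
    (λ i 1≤i i≤n → ≤-trans 1≤i (≤core up 1≤i i≤n) , ≤-trans (core≤ up 1≤i i≤n) (proj₂ (tuple i 1≤i i≤n))) , core-upper up

  UI-core : ∀ {β} → U n lam β → UI n lam (core n lam β)
  UI-core u@(_ , up) = U-core u , λ i k 1≤i i<k k≤n same →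
    ≤ᵈ-<⇒< (core-slope up 1≤i (<⇒≤ i<k) (subst (k ≤_) (sym same) (i≤top k≤n)) k≤n) i<k

  UI⇒core≈ : ∀ {γ} → UI n lam γ → core n lam γ ≈[ n ] γ
  UI⇒core≈ {γ} ((_ , up) , increasing) i 1≤i i≤n = coreValue-unique (coreValue up 1≤i i≤n)
    ((λ k i≤k k≤t → stepwise-<⇒≤ᵈ γ i≤k λ m i≤m m<k →
        increasing m (suc m) (≤-trans 1≤i i≤m) ≤-refl (k≤n′ m<k k≤t) (same i≤m m<k k≤t)) ,
     i , ≤-refl , i≤top i≤n , ≤ᵈ-refl)
    where
    k≤n′ : ∀ {m k} → m < k → k ≤ top i → suc m ≤ n
    k≤n′ m<k k≤t = ≤-trans m<k (inCarrel≤n i≤n k≤t)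
    same : ∀ {m k} → i ≤ m → m < k → k ≤ top i → SameCarrel n lam m (suc m)
    same i≤m m<k k≤t = trans (top-sameCarrel i≤m (≤-trans (n≤1+n _) (≤-trans m<k k≤t)) (≤-trans (n≤1+n _) (k≤n′ m<k k≤t)))
                             (sym (top-sameCarrel (≤-trans i≤m (n≤1+n _)) (≤-trans m<k k≤t) (k≤n′ m<k k≤t)))

  sim-core : ∀ {β} → U n lam β → Sim n lam (core n lam β) β
  sim-core u@(_ , up) = core≈⇒sim (core-upper up) up (core-idem up)

  sim⇔core≈ : ∀ {β β′} → U n lam β → U n lam β′ → Sim n lam β β′ ⇔ (core n lam β ≈[ n ] core n lam β′)
  sim⇔core≈ u u′ = mk⇔ (sim⇒core≈ u u′) (core≈⇒sim (proj₂ u) (proj₂ u′))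

  UI-representative : ∀ β → U n lam β →
    ∃ λ γ → UI n lam γ × Sim n lam γ β ×
      (∀ γ′ → UI n lam γ′ → Sim n lam γ′ β → γ′ ≈[ n ] γ) ×
      (∀ β″ → U n lam β″ → Sim n lam β″ β → γ ≤[ n ] β″)
  UI-representative β u = core n lam β , UI-core u , sim-core u ,
    (λ γ′ ui sim i 1≤i i≤n → trans (sym (UI⇒core≈ ui i 1≤i i≤n)) (sim⇒core≈ (proj₁ ui) u sim i 1≤i i≤n)) ,
    (λ β″ u″ sim i 1≤i i≤n → ≤-trans (≤-reflexive (sym (sim⇒core≈ u″ u sim i 1≤i i≤n)))
                                     (core≤ (proj₂ u″) 1≤i i≤n))

  critical-cong : ∀ {f g x} → f ≈[ n ] g → Critical f x → Critical g x
  critical-cong {f} {g} {x} f≈g (1≤x , x≤n , strict) = 1≤x , x≤n , λ k x<k k≤t →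
    subst₂ (λ a b → (a , x) <ᵈ (b , k)) (f≈g x 1≤x x≤n) (f≈g k (≤-trans 1≤x (<⇒≤ x<k)) (inCarrel≤n x≤n k≤t))
           (strict k x<k k≤t)

  sim⇒critical : ∀ {β η x} → U n lam β → U n lam η → Sim n lam β η → Critical β x → Critical η x × β x ≡ η x
  sim⇒critical {β} {η} {x} u@(_ , up) u′@(_ , up′) sim c = c′ , (begin
      β x              ≡⟨ sym (critical⇒core≡ up c) ⟩
      core n lam β x   ≡⟨ core≈ x (proj₁ c) (proj₁ (proj₂ c)) ⟩
      core n lam η x   ≡⟨ critical⇒core≡ up′ c′ ⟩
      η x              ∎)
    where
    open ≡-Reasoning
    core≈ : core n lam β ≈[ n ] core n lam η
    core≈ = sim⇒core≈ u u′ sim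
    c′ : Critical η x
    c′ = critical-core⇒critical up′ (critical-cong core≈ (critical⇒critical-core up c))

  sim⇒UGC : ∀ η β → UGC n lam η → U n lam β → Sim n lam β η → UGC n lam β
  sim⇒UGC η β (uη , ordered) u sim = u , λ x x′ cx cx′ x<x′ →
    let cη , βx≡ = sim⇒critical u uη sim (isCritical⇒critical cx)
        cη′ , βx′≡ = sim⇒critical u uη sim (isCritical⇒critical cx′) in
    subst₂ _≤_ (sym βx≡) (sym βx′≡) (ordered x x′ (critical⇒isCritical cη) (critical⇒isCritical cη′) x<x′)

  UG-representative : ∀ η → UGC n lam η →
    ∃ λ γ → UG n lam γ × Sim n lam γ η ×
      (∀ γ′ → UG n lam γ′ → Sim n lam γ′ η → γ′ ≈[ n ] γ) ×
      (∀ η″ → UGC n lam η″ → Sim n lam η″ η → γ ≤[ n ] η″)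
  UG-representative η ugc@(u , _) =
    let γ , ui , sim , unique , minimum = UI-representative η u in
    γ , (sim⇒UGC η γ ugc (proj₁ ui) sim , ui) , sim ,
    (λ γ′ ug → unique γ′ (proj₂ ug)) , (λ η″ ugc″ → minimum η″ (proj₁ ugc″))

-- the value of g at a lower carrel boundary; the boundary q_0 = 0 contributes nothing
atLowerBoundary : (ℕ → ℕ) → ℕ → ℕ
atLowerBoundary g zero = 0
atLowerBoundary g (suc b) = g (suc b)

atLowerBoundary-pos : ∀ {g b} → 1 ≤ b → atLowerBoundary g b ≡ g b
atLowerBoundary-pos {b = suc b} _ = refl

atLowerBoundary≤ : ∀ {g b m} → (1 ≤ b → g b ≤ m) → atLowerBoundary g b ≤ m
atLowerBoundary≤ {b = zero} _ = z≤n
atLowerBoundary≤ {b = suc b} bound = bound (s≤s z≤n)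

atLowerBoundary-pos⁻ : ∀ {g b} → 1 ≤ atLowerBoundary g b → 1 ≤ b
atLowerBoundary-pos⁻ {b = suc b} _ = s≤s z≤n

module Floors (n : ℕ) (lam : ℕ → ℕ) (P : IsPartition n lam) (1≤n : 1 ≤ n) where
  open Representatives n lam P 1≤n public

  floorOf : (ℕ → ℕ) → ℕ → ℕ
  floorOf g i = g i ⊔ atLowerBoundary g (bot i)

  upperBoundary-critical : ∀ {β t} → 1 ≤ t → t ≤ n → UpperBoundary t → Critical β t
  upperBoundary-critical 1≤t t≤n bt =
    1≤t , t≤n , λ k t<k k≤t → ⊥-elim (<⇒≱ t<k (subst (_ ≤_) (top-upperBoundary-self t≤n bt) k≤t))

  bot-critical : ∀ {β i} → 1 ≤ i → i ≤ n → 1 ≤ bot i → Critical β (bot i)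
  bot-critical 1≤i i≤n 1≤b = upperBoundary-critical 1≤b (bot≤n 1≤i i≤n) (inj₂ (lowerBoundary⇒inR 1≤b (bot-lowerBoundary 1≤i)))

  floorOf-cong : ∀ {g g′} → g ≈[ n ] g′ → floorOf g ≈[ n ] floorOf g′
  floorOf-cong {g} {g′} g≈g′ i 1≤i i≤n = cong₂ _⊔_ (g≈g′ i 1≤i i≤n) boundary
    where
    boundary : atLowerBoundary g (bot i) ≡ atLowerBoundary g′ (bot i)
    boundary with bot i | bot≤n 1≤i i≤n
    ... | zero | _ = refl
    ... | suc b | b≤n = g≈g′ (suc b) (s≤s z≤n) b≤n

  floorFlag-stall : ∀ {τ′ m} → IsFloorFlag n lam τ′ → 1 ≤ m → m < n → τ′ (suc m) ≤ τ′ m →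
    ∃ λ s → s ≤ m × InR s × (∀ k → s ≤ k → k ≤ m → τ′ k ≡ τ′ s)
  floorFlag-stall {τ′} {m} ((_ , mono) , flag) 1≤m m<n stall
    with s , 1≤s , s≤m , constant-s , start ← plateauStart τ′ 1≤m
    with e , m≤e , e≤n , constant-e , end ← plateauEnd τ′ (<⇒≤ m<n) =
    s , s≤m , flag s e 1≤s (≤-<-trans s≤m (m<e end)) e≤n constant start end , constant-s
    where
    flat : τ′ (suc m) ≡ τ′ m
    flat = ≤-antisym stall (mono m (suc m) 1≤m (n≤1+n m) m<n)
    m<e : e ≡ n ⊎ τ′ (suc e) ≢ τ′ e → m < e
    m<e end with m≤n⇒m<n∨m≡n m≤e | end
    ... | inj₁ m<e | _ = m<e
    ... | inj₂ refl | inj₁ m≡n = ⊥-elim (<⇒≢ m<n m≡n)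
    ... | inj₂ refl | inj₂ step = ⊥-elim (step flat)
    constant : ∀ k → s ≤ k → k ≤ e → τ′ k ≡ τ′ s
    constant k s≤k k≤e with k ≤? m
    ... | yes k≤m = constant-s k s≤k k≤m
    ... | no k≰m = trans (constant-e k (<⇒≤ (≰⇒> k≰m)) k≤e) (constant-s m s≤m ≤-refl)

  FirstCritical : (ℕ → ℕ) → ℕ → ℕ → Set
  FirstCritical β i y = bot i < y × y ≤ top i × Critical β y × (∀ z → suc (bot i) ≤ z → z < y → ¬ IsCritical n lam β z)

  firstCritOfCarrel-spec : ∀ β {i} → 1 ≤ i → i ≤ n → FirstCritical β i (firstCritOfCarrel n lam β i)
  firstCritOfCarrel-spec β {i} 1≤i i≤n
    with findFirst (isCrit n lam β) (interval (suc (bot i)) (top i)) | findFirst-interval (isCrit n lam β) (suc (bot i)) (top i)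
  ... | _ | none miss = ⊥-elim (miss (top i) (≤-trans (bot<i 1≤i) (i≤top i≤n)) ≤-refl
          (critical⇒isCritical (upperBoundary-critical (≤-trans 1≤i (i≤top i≤n)) (top≤n i≤n) (top-upperBoundary i≤n))))
  ... | _ | found b<y y≤t hit earlier = b<y , y≤t , isCritical⇒critical hit , earlier

  floorMap-cases : ∀ {g i v} →
    (IsCritical n lam g i → g i ≡ v) →
    (InR (bot i) → g (bot i) ⊔ core n lam g i ≡ v) →
    (¬ T (inR n lam (bot i) ∧ ⌊ nextCrit n lam g i ≟ firstCritOfCarrel n lam g i ⌋) → core n lam g i ≡ v) →
    floorMap n lam g i ≡ v
  floorMap-cases {g} {i} critical boundary other = if-cases (isCrit n lam g i) critical λ _ →
    if-cases (inR n lam (bot i) ∧ ⌊ nextCrit n lam g i ≟ firstCritOfCarrel n lam g i ⌋)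
             (λ t → boundary (proj₁ (Equivalence.to (T-∧ {inR n lam (bot i)}) t))) other

  module Floor {φ : ℕ → ℕ} (uf : UF n lam φ) where

    u : U n lam φ
    u = proj₁ uf
    up : IsUpperB n φ
    up = proj₂ u
    φ-mono : ∀ i k → 1 ≤ i → i ≤ k → k ≤ n → φ i ≤ φ k
    φ-mono = proj₂ uf
    g : ℕ → ℕ
    g = core n lam φ
    τ : ℕ → ℕ
    τ = floorOf g

    g-bot : ∀ {i} → 1 ≤ i → i ≤ n → 1 ≤ bot i → g (bot i) ≡ φ (bot i)
    g-bot 1≤i i≤n 1≤b = critical⇒core≡ up (bot-critical 1≤i i≤n 1≤b)

    atLowerBoundary≤φ : ∀ {i k} → 1 ≤ i → i ≤ k → k ≤ n → atLowerBoundary g (bot i) ≤ φ k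
    atLowerBoundary≤φ 1≤i i≤k k≤n = atLowerBoundary≤ λ 1≤b →
      ≤-trans (≤-reflexive (g-bot 1≤i (≤-trans i≤k k≤n) 1≤b)) (φ-mono _ _ 1≤b (≤-trans (<⇒≤ (bot<i 1≤i)) i≤k) k≤n)

    g≤τ : ∀ i → g i ≤ τ i
    g≤τ i = m≤m⊔n (g i) _

    τ≤φ : ∀ {i} → 1 ≤ i → i ≤ n → τ i ≤ φ i
    τ≤φ 1≤i i≤n = ⊔-lub (core≤ up 1≤i i≤n) (atLowerBoundary≤φ 1≤i ≤-refl i≤n)

    τ-upper : IsUpperB n τ
    τ-upper i 1≤i i≤n = ≤-trans (≤core up 1≤i i≤n) (g≤τ i)

    τ-mono : ∀ i k → 1 ≤ i → i ≤ k → k ≤ n → τ i ≤ τ k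
    τ-mono i k 1≤i i≤k k≤n with k ≤? top i
    ... | yes k≤t = ⊔-mono-≤ (≤ᵈ-≤⇒≤ (core-slope up 1≤i i≤k k≤t k≤n) i≤k)
                             (≤-reflexive (cong (atLowerBoundary g) (sym (bot-sameCarrel 1≤i i≤k k≤t k≤n))))
    ... | no k≰t = begin
      τ i                           ≤⟨ τ≤φ 1≤i (≤-trans i≤k k≤n) ⟩
      φ i                           ≤⟨ φ-mono i (bot k) 1≤i i≤b (bot≤n 1≤k k≤n) ⟩
      φ (bot k)                     ≡⟨ sym (g-bot 1≤k k≤n 1≤b) ⟩
      g (bot k)                     ≡⟨ sym (atLowerBoundary-pos 1≤b) ⟩
      atLowerBoundary g (bot k)     ≤⟨ m≤n⊔m (g k) _ ⟩
      τ k                           ∎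
      where
      open ≤-Reasoning
      1≤k : 1 ≤ k
      1≤k = ≤-trans 1≤i i≤k
      i≤b : i ≤ bot k
      i≤b = ≤-trans (i≤top (≤-trans i≤k k≤n)) (top≤bot (≤-trans i≤k k≤n) k≤n 1≤k (≰⇒> k≰t))
      1≤b : 1 ≤ bot k
      1≤b = ≤-trans 1≤i i≤b

    τ-UF : UF n lam τ
    τ-UF = ((λ i 1≤i i≤n → ≤-trans 1≤i (τ-upper i 1≤i i≤n) , ≤-trans (τ≤φ 1≤i i≤n) (proj₂ (proj₁ u i 1≤i i≤n))) , τ-upper) ,
           τ-mono

    -- τ lies between core φ and φ, so it has the same core.
    core-τ : core n lam τ ≈[ n ] g
    core-τ i 1≤i i≤n =
      let _ , k , i≤k , k≤t , attained = coreValue up 1≤i i≤n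
          k≤n = inCarrel≤n i≤n k≤t in
      coreValue-unique (coreValue τ-upper 1≤i i≤n)
        ((λ k i≤k k≤t → ≤ᵈ-trans (core-slope up 1≤i i≤k k≤t (inCarrel≤n i≤n k≤t)) (≤⇒≤ᵈ (g≤τ k))) ,
         k , i≤k , k≤t , ≤ᵈ-trans (≤⇒≤ᵈ (τ≤φ (≤-trans 1≤i i≤k) k≤n)) attained)

    τ-sim : Sim n lam τ φ
    τ-sim = core≈⇒sim τ-upper up core-τ

    τ-minimum : ∀ φ″ → UF n lam φ″ → Sim n lam φ″ φ → τ ≤[ n ] φ″
    τ-minimum φ″ (u″@(_ , up″) , mono″) sim i 1≤i i≤n = ⊔-lub
      (≤-trans (≤-reflexive (sym (core≈ i 1≤i i≤n))) (core≤ up″ 1≤i i≤n))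
      (atLowerBoundary≤ λ 1≤b → let b≤n = bot≤n 1≤i i≤n in
        ≤-trans (≤-reflexive (sym (core≈ _ 1≤b b≤n)))
                (≤-trans (core≤ up″ 1≤b b≤n) (mono″ _ i 1≤b (<⇒≤ (bot<i 1≤i)) i≤n)))
      where
      core≈ : core n lam φ″ ≈[ n ] g
      core≈ = sim⇒core≈ u″ u sim

    -- Inside a carrel the core rises strictly, so τ can only stay flat where the value at the carrel's
    -- lower boundary dominates; but then τ is already flat from that boundary on.
    τ-flatStart-inCarrel : ∀ {s} → 1 ≤ s → s < top s → suc s ≤ n → τ (suc s) ≡ τ s → ¬ (s ≡ 1 ⊎ τ (s ∸ 1) ≢ τ s)
    τ-flatStart-inCarrel {s} 1≤s s<t ss≤n τss≡τs = startAtBoundary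
      where
      s≤n : s ≤ n
      s≤n = ≤-trans (n≤1+n s) ss≤n
      A : ℕ
      A = atLowerBoundary g (bot s)
      gs<gss : g s < g (suc s)
      gs<gss = ≤ᵈ-<⇒< (core-slope up 1≤s (n≤1+n s) s<t ss≤n) ≤-refl
      A-same : atLowerBoundary g (bot (suc s)) ≡ A
      A-same = cong (atLowerBoundary g) (bot-sameCarrel 1≤s (n≤1+n s) s<t ss≤n)
      gss≤A : g (suc s) ≤ A
      gss≤A = ≮⇒≥ λ A<gss → <⇒≢ (⊔-lub gs<gss A<gss)
        (trans (sym τss≡τs) (trans (cong (g (suc s) ⊔_) A-same) (m≥n⇒m⊔n≡m (<⇒≤ A<gss))))
      τs≡A : τ s ≡ A
      τs≡A = trans (sym τss≡τs) (trans (cong (g (suc s) ⊔_) A-same) (m≤n⇒m⊔n≡n gss≤A))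
      1≤b : 1 ≤ bot s
      1≤b = atLowerBoundary-pos⁻ (≤-trans (≤-trans (s≤s z≤n) (≤core up (s≤s z≤n) ss≤n)) gss≤A)
      b<s : bot s < s
      b<s = bot<i 1≤s
      τb≡A : τ (bot s) ≡ A
      τb≡A = trans (m≥n⇒m⊔n≡m (≤-trans (atLowerBoundary≤φ 1≤b ≤-refl (bot≤n 1≤s s≤n))
                                       (≤-reflexive (sym (g-bot 1≤s s≤n 1≤b)))))
                   (sym (atLowerBoundary-pos 1≤b))
      startAtBoundary : ¬ (s ≡ 1 ⊎ τ (s ∸ 1) ≢ τ s)
      startAtBoundary (inj₁ refl) = <⇒≱ b<s 1≤b
      startAtBoundary (inj₂ step) = step (≤-antisym
        (τ-mono (s ∸ 1) s (≤-trans 1≤b (<⇒≤∸1 b<s)) (m∸n≤m s 1) s≤n)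
        (≤-trans (≤-reflexive (trans τs≡A (sym τb≡A)))
                 (τ-mono (bot s) (s ∸ 1) 1≤b (<⇒≤∸1 b<s) (≤-trans (m∸n≤m s 1) s≤n))))

    τ-floorFlag : IsFloorFlag n lam τ
    τ-floorFlag = τ-UF , λ s e 1≤s s<e e≤n constant start _ →
      [ (λ s<t → ⊥-elim (τ-flatStart-inCarrel 1≤s s<t (≤-trans s<e e≤n) (constant (suc s) (n≤1+n s) s<e) start)) ,
        (λ s≡t → [ (λ t≡n → ⊥-elim (<⇒≱ (≤-trans s<e e≤n) (≤-reflexive (sym (trans s≡t t≡n))))) , subst InR (sym s≡t) ]′
                   (top-upperBoundary (≤-trans (<⇒≤ s<e) e≤n))) ]′
        (m≤n⇒m<n∨m≡n (i≤top (≤-trans (<⇒≤ s<e) e≤n)))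

    -- A floor flag τ′ equivalent to φ lies below τ: where τ′ rises strictly up to the core's minimiser it
    -- is bounded by the core, and where it stalls it is flat back to the lower boundary of the carrel.
    floorFlag≤τ : ∀ τ′ → IsFloorFlag n lam τ′ → Sim n lam τ′ φ → τ′ ≤[ n ] τ
    floorFlag≤τ τ′ ff@(((_ , up′) , _) , _) sim i 1≤i i≤n =
      let _ , k , i≤k , k≤t , attained = coreValue up′ 1≤i i≤n
          k≤n = inCarrel≤n i≤n k≤t in
      [ (λ steps → ≤-trans (≤ᵈ⇒≤ (≤ᵈ-trans (stepwise-<⇒≤ᵈ τ′ i≤k steps) attained))
                           (≤-trans (≤-reflexive (core≈ i 1≤i i≤n)) (g≤τ i))) ,
        (λ (m , i≤m , m<k , stall) → viaStall m i≤m (≤-trans m<k k≤t) (<-≤-trans m<k k≤n) stall) ]′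
        (stepwise-<-or-stall τ′ i k i≤k)
      where
      core≈ : core n lam τ′ ≈[ n ] g
      core≈ = sim⇒core≈ (proj₁ (proj₁ ff)) u sim
      viaStall : ∀ m → i ≤ m → m < top i → m < n → τ′ (suc m) ≤ τ′ m → τ′ i ≤ τ i
      viaStall m i≤m m<t m<n stall =
        let s , s≤m , r , constant = floorFlag-stall ff (≤-trans 1≤i i≤m) m<n stall
            s<i = ≰⇒> λ i≤s → <⇒≱ (≤-<-trans s≤m m<t) (top≤inR i≤n r i≤s)
            s≤b = inR≤bot 1≤i r s<i
            1≤b = ≤-trans (proj₁ (inR⇒descent r)) s≤b
            b≤n = bot≤n 1≤i i≤n in
        begin
          τ′ i                        ≡⟨ constant i (<⇒≤ s<i) i≤m ⟩
          τ′ s                        ≡⟨ sym (constant (bot i) s≤b (≤-trans (<⇒≤ (bot<i 1≤i)) i≤m)) ⟩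
          τ′ (bot i)                  ≡⟨ sym (critical⇒core≡ up′ (bot-critical 1≤i i≤n 1≤b)) ⟩
          core n lam τ′ (bot i)       ≡⟨ core≈ (bot i) 1≤b b≤n ⟩
          g (bot i)                   ≡⟨ sym (atLowerBoundary-pos 1≤b) ⟩
          atLowerBoundary g (bot i)   ≤⟨ m≤n⊔m (g i) _ ⟩
          τ i                         ∎
        where open ≤-Reasoning

    critical-g⇒g≡φ : ∀ {x} → Critical g x → g x ≡ φ x
    critical-g⇒g≡φ c = critical⇒core≡ up (critical-core⇒critical up c)

    lowerBoundary≤g : ∀ {i y} → 1 ≤ i → i ≤ n → Critical g y → bot i < y → y ≤ i → atLowerBoundary g (bot i) ≤ g i
    lowerBoundary≤g {i} {y} 1≤i i≤n c b<y y≤i = atLowerBoundary≤ λ 1≤b → begin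
      g (bot i)   ≡⟨ g-bot 1≤i i≤n 1≤b ⟩
      φ (bot i)   ≤⟨ φ-mono (bot i) y 1≤b (<⇒≤ b<y) (≤-trans y≤i i≤n) ⟩
      φ y         ≡⟨ sym (critical-g⇒g≡φ c) ⟩
      g y         ≤⟨ ≤ᵈ-≤⇒≤ (core-slope up (proj₁ c) y≤i i≤ty i≤n) y≤i ⟩
      g i         ∎
      where
      open ≤-Reasoning
      i≤ty : i ≤ top y
      i≤ty = subst (i ≤_) (sym (top-sameBot 1≤i i≤n b<y (≤-trans y≤i (i≤top i≤n)))) (i≤top i≤n)

    τ≡g : ∀ {i} → atLowerBoundary g (bot i) ≤ g i → τ i ≡ g i
    τ≡g A≤g = m≥n⇒m⊔n≡m A≤g

    floorMap≡τ : floorMap n lam g ≈[ n ] τ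
    floorMap≡τ i 1≤i i≤n = floorMap-cases {g} {i}
      (λ c → sym (τ≡g {i} (lowerBoundary≤g 1≤i i≤n (isCritical⇒critical c) (bot<i 1≤i) ≤-refl)))
      (λ r → let 1≤b = proj₁ (inR⇒descent {bot i} r) in
        trans (cong (g (bot i) ⊔_) g-idem) (trans (⊔-comm (g (bot i)) (g i)) (cong (g i ⊔_) (sym (atLowerBoundary-pos 1≤b)))))
      (λ ¬t → trans g-idem (sym (τ≡g {i} (atLowerBoundary≤ λ 1≤b →
        ≤-trans (≤-reflexive (sym (atLowerBoundary-pos 1≤b))) (viaFirstCritical ¬t 1≤b)))))
      where
      g-idem : core n lam g i ≡ g i
      g-idem = core-idem up i 1≤i i≤n
      x y : ℕ
      x = nextCrit n lam g i
      y = firstCritOfCarrel n lam g i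
      viaFirstCritical : ¬ T (inR n lam (bot i) ∧ ⌊ x ≟ y ⌋) → 1 ≤ bot i → atLowerBoundary g (bot i) ≤ g i
      viaFirstCritical ¬t 1≤b =
        let i≤x , _ , critical-x , _ , before-x = nextCrit-spec g 1≤i i≤n
            b<y , _ , critical-y , before-y = firstCritOfCarrel-spec g 1≤i i≤n
            r = lowerBoundary⇒inR 1≤b (bot-lowerBoundary 1≤i)
            x≢y : x ≢ y
            x≢y x≡y = ¬t (Equivalence.from (T-∧ {inR n lam (bot i)}) (r , fromWitness x≡y))
            y<i = ≰⇒> λ i≤y → x≢y (≤-antisym
                    (≮⇒≥ λ y<x → before-x y i≤y y<x (critical⇒isCritical critical-y))
                    (≮⇒≥ λ x<y → before-y x (≤-trans (bot<i 1≤i) i≤x) x<y (critical⇒isCritical critical-x))) in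
        lowerBoundary≤g 1≤i i≤n critical-y b<y (<⇒≤ y<i)

    core-UG : UG n lam g
    core-UG = (U-core u , λ x x′ cx cx′ x<x′ →
      let c = isCritical⇒critical cx
          c′ = isCritical⇒critical cx′ in
      subst₂ _≤_ (sym (critical-g⇒g≡φ c)) (sym (critical-g⇒g≡φ c′))
                 (φ-mono x x′ (proj₁ c) (<⇒≤ x<x′) (proj₁ (proj₂ c′)))) ,
      UI-core u

  floorFlag-representative : ∀ φ → UF n lam φ →
    ∃ λ τ → IsFloorFlag n lam τ × Sim n lam τ φ ×
      (∀ τ′ → IsFloorFlag n lam τ′ → Sim n lam τ′ φ → τ′ ≈[ n ] τ) ×
      (∀ φ″ → UF n lam φ″ → Sim n lam φ″ φ → τ ≤[ n ] φ″)
  floorFlag-representative φ uf = τ , τ-floorFlag , τ-sim ,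
    (λ τ′ ff sim i 1≤i i≤n → ≤-antisym (floorFlag≤τ τ′ ff sim i 1≤i i≤n) (τ-minimum τ′ (proj₁ ff) sim i 1≤i i≤n)) ,
    τ-minimum
    where open Floor uf

  sim⇔floorMap≈ : ∀ {φ φ′} → UF n lam φ → UF n lam φ′ →
    Sim n lam φ φ′ ⇔ (floorMap n lam (core n lam φ) ≈[ n ] floorMap n lam (core n lam φ′))
  sim⇔floorMap≈ {φ} {φ′} uf uf′ = mk⇔
    (λ sim → floorMap≈ (floorOf-cong (sim⇒core≈ (proj₁ uf) (proj₁ uf′) sim)))
    (λ fm≈ → core≈⇒sim (proj₂ (proj₁ uf)) (proj₂ (proj₁ uf′)) λ i 1≤i i≤n → begin
      core n lam φ i                ≡⟨ sym (F.core-τ i 1≤i i≤n) ⟩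
      core n lam F.τ i              ≡⟨ core-cong F.τ-upper F′.τ-upper (floorMap≈⁻ fm≈) i 1≤i i≤n ⟩
      core n lam F′.τ i             ≡⟨ F′.core-τ i 1≤i i≤n ⟩
      core n lam φ′ i               ∎)
    where
    open ≡-Reasoning
    module F = Floor uf
    module F′ = Floor uf′
    floorMap≈ : F.τ ≈[ n ] F′.τ → floorMap n lam F.g ≈[ n ] floorMap n lam F′.g
    floorMap≈ τ≈ i 1≤i i≤n = trans (F.floorMap≡τ i 1≤i i≤n) (trans (τ≈ i 1≤i i≤n) (sym (F′.floorMap≡τ i 1≤i i≤n)))
    floorMap≈⁻ : floorMap n lam F.g ≈[ n ] floorMap n lam F′.g → F.τ ≈[ n ] F′.τ
    floorMap≈⁻ fm≈ i 1≤i i≤n = trans (sym (F.floorMap≡τ i 1≤i i≤n)) (trans (fm≈ i 1≤i i≤n) (F′.floorMap≡τ i 1≤i i≤n))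

proposition8p3 : (n : ℕ) → 1 ≤ n → (lam : ℕ → ℕ) → IsPartition n lam →
    -- (i)
    ((∀ β → U n lam β →
        ∃ λ γ → UI n lam γ × Sim n lam γ β ×
          (∀ γ' → UI n lam γ' → Sim n lam γ' β → γ' ≈[ n ] γ) ×
          (∀ β'' → U n lam β'' → Sim n lam β'' β → γ ≤[ n ] β'')) ×
     (∀ β β' → U n lam β → U n lam β' →
        Sim n lam β β' ⇔ (core n lam β ≈[ n ] core n lam β'))) ×
    -- (ii)
    ((∀ η → UGC n lam η →
        ∃ λ γ → UG n lam γ × Sim n lam γ η ×
          (∀ γ' → UG n lam γ' → Sim n lam γ' η → γ' ≈[ n ] γ) ×
          (∀ η'' → UGC n lam η'' → Sim n lam η'' η → γ ≤[ n ] η'')) ×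
     (∀ η β → UGC n lam η → U n lam β → Sim n lam β η → UGC n lam β) ×
     (∀ η η' → UGC n lam η → UGC n lam η' →
        Sim n lam η η' ⇔ (core n lam η ≈[ n ] core n lam η'))) ×
    -- (iii)
    ((∀ φ → UF n lam φ →
        ∃ λ τ → IsFloorFlag n lam τ × Sim n lam τ φ ×
          (∀ τ' → IsFloorFlag n lam τ' → Sim n lam τ' φ → τ' ≈[ n ] τ) ×
          (∀ φ'' → UF n lam φ'' → Sim n lam φ'' φ → τ ≤[ n ] φ'')) ×
     (∀ φ φ' → UF n lam φ → UF n lam φ' →
        Sim n lam φ φ' ⇔
          (floorMap n lam (core n lam φ) ≈[ n ] floorMap n lam (core n lam φ'))) ×
     (∀ φ → UF n lam φ → UG n lam (core n lam φ) × Sim n lam φ (core n lam φ)) ×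
     (∀ φ φ' → UF n lam φ → UF n lam φ' →
        (core n lam φ ≈[ n ] core n lam φ') ⇔ Sim n lam φ φ'))
proposition8p3 n 1≤n lam P =
  (UI-representative , λ _ _ → sim⇔core≈) ,
  (UG-representative , sim⇒UGC , λ _ _ ugc ugc′ → sim⇔core≈ (proj₁ ugc) (proj₁ ugc′)) ,
  (floorFlag-representative ,
   (λ _ _ → sim⇔floorMap≈) ,
   (λ _ uf → Floor.core-UG uf , sim-sym (sim-core (proj₁ uf))) ,
   λ _ _ uf uf′ → ⇔-sym (sim⇔core≈ (proj₁ uf) (proj₁ uf′)))
  where open Floors n lam P 1≤n
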